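{- Fix $N\ge2$ and consider prefixes for $I_N=\mathrm{Av}_N(123)$. The strike probabilities are: $S_N(p)=\mathcal{C}(N-1,k-1)/\mathcal{C}(N-1,k-1)$ if $p=(k-1)(k-2)\cdots 2\,1\,k$ with $2\le k\le N$; $S_N(p)=\mathcal{C}_{N-1}/\mathcal{C}_N$ if $p=1$; and $S_N(p)$ has numerator $0$ otherwise. Consequently, the strategy of accepting the second left-to-right maximum (accepting the last candidate if there is none) is optimal for the restricted game of best choice on $\mathrm{Av}_N(123)$, and its success probability tends to $3/4$ as $N\to\infty$.
   Context: $\mathrm{Av}_N(123)$ is the set of permutations $\pi=\pi_1\cdots\pi_N$ of $[N]$ with no indices $a<b<c$ such that $\pi_a<\pi_b<\pi_c$. $\pi|_{[k]}$ is the permutation of $[k]$ in the same relative order as $\pi_1,\dots,\pi_k$; a prefix of size $k$ is any $\pi|_{[k]}$ with $\pi\in I_N$. The strike probability of a prefix $p$ of size $k$ is the pair $S_N(p)=\big(\#\{\pi\in I_N:\pi|_{[k]}=p,\ \pi_k=N\},\ \#\{\pi\in I_N:\pi|_{[k]}=p\}\big)$. $\mathcal{C}_n=\frac1{n+1}\binom{2n}{n}$ are the Catalan numbers and $\mathcal{C}(n,k)=\frac{k+1}{n+1}\binom{2n-k}{n}$ the ballot numbers. An entry $\pi_j$ is a left-to-right maximum if $\pi_j>\pi_l$ for all $l<j$. Restricted game of best choice on $I_N$: $\pi$ uniform from $I_N$; for $i=1,2,\dots$ the player sees $\pi|_{[i]}$ and, using only what has been seen, accepts candidate $i$ (ending the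 game) or rejects it forever; candidate $N$ is accepted if all earlier are rejected; the player wins iff the accepted candidate $i$ has $\pi_i=N$. A strategy is optimal if it maximizes the winning probability. -}

module Defs where

open import Data.Nat using (ℕ; zero; suc; _+_; _*_; _∸_; _/_; _<ᵇ_; _≡ᵇ_)
open import Data.Nat.Combinatorics using (_C_)
open import Data.Bool using (Bool; true; false; _∧_; _∨_; not; if_then_else_)
open import Data.Fin using (Fin; toℕ)
open import Data.List using (List; []; _∷_; [_]; _++_; map; concatMap; upTo; length; filterᵇ;
  take; lookup; allFin; reverse; findᵇ)
open import Data.Bool.ListAction using (any; all)
open import Data.List.Properties using (≡-dec)
open import Data.Nat.Properties using (_≟_)
open import Data.Maybe using (Maybe; just; nothing; fromMaybe)
open import Data.Product using (_×_; _,_; ∃)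
open import Data.Integer using (+_)
open import Data.Rational using (ℚ; 0ℚ) renaming (_/_ to _/ℚ_)
open import Data.List.Membership.Propositional using (_∈_)
open import Relation.Binary.PropositionalEquality using (_≡_)
open import Relation.Nullary using (does)

-- Catalan and ballot numbers (exact divisions in ℕ)

catalan : ℕ → ℕ
catalan n = ((2 * n) C n) / suc n

ballot : ℕ → ℕ → ℕ
ballot n k = ((suc k) * ((2 * n ∸ k) C n)) / suc n

-- Words / permutations, represented as lists of naturals (values 1..N)

count : {A : Set} → (A → Bool) → List A → ℕ
count p xs = length (filterᵇ p xs)

words : ℕ → ℕ → List (List ℕ)
words m zero    = [ [] ]
words m (suc n) = concatMap (λ x → map (x ∷_) (words m n)) (map suc (upTo m))

_<F_ : {n : ℕ} → Fin n → Fin n → Bool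
i <F j = toℕ i <ᵇ toℕ j

distinct : List ℕ → Bool
distinct xs = all (λ i → all (λ j → not (i <F j) ∨ not (lookup xs i ≡ᵇ lookup xs j))
                                 (allFin (length xs))) (allFin (length xs))

contains123 : List ℕ → Bool
contains123 xs = any (λ a → any (λ b → any (λ c →
    (a <F b) ∧ (b <F c) ∧ (lookup xs a <ᵇ lookup xs b) ∧ (lookup xs b <ᵇ lookup xs c))
    (allFin (length xs))) (allFin (length xs))) (allFin (length xs))

Av123 : ℕ → List (List ℕ)
Av123 N = filterᵇ (λ π → distinct π ∧ not (contains123 π)) (words N N)

std : List ℕ → List ℕ
std xs = map (λ x → suc (count (_<ᵇ x) xs)) xs

restrict : List ℕ → ℕ → List ℕ
restrict π k = std (take k π)

-- π_k (1-indexed; 0 if out of range)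
at : List ℕ → ℕ → ℕ
at []       _             = 0
at (x ∷ xs) zero          = 0
at (x ∷ xs) (suc zero)    = x
at (x ∷ xs) (suc (suc k)) = at xs (suc k)

_==L_ : List ℕ → List ℕ → Bool
p ==L q = does (≡-dec _≟_ p q)

IsPrefix : ℕ → ℕ → List ℕ → Set
IsPrefix N k p = ∃ λ π → π ∈ Av123 N × restrict π k ≡ p

-- strike probability as a pair (numerator, denominator)
strike : ℕ → ℕ → List ℕ → ℕ × ℕ
strike N k p =
  ( count (λ π → (restrict π k ==L p) ∧ (at π k ≡ᵇ N)) (Av123 N)
  , count (λ π → restrict π k ==L p) (Av123 N) )

down : ℕ → List ℕ
down zero    = []
down (suc n) = suc n ∷ down n

staircase : ℕ → List ℕ
staircase k = down (k ∸ 1) ++ [ k ]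

-- a (deterministic) strategy decides, from the seen prefix π|[i], whether to accept candidate i
Strategy : Set
Strategy = List ℕ → Bool

accepted : Strategy → ℕ → List ℕ → ℕ
accepted σ N π = fromMaybe N (findᵇ (λ i → σ (restrict π i)) (map suc (upTo (N ∸ 1))))

wins : Strategy → ℕ → ℕ
wins σ N = count (λ π → at π (accepted σ N π) ≡ᵇ N) (Av123 N)

_÷_ : ℕ → ℕ → ℚ
m ÷ zero  = 0ℚ
m ÷ suc n = (+ m) /ℚ (suc n)

winProb : Strategy → ℕ → ℚ
winProb σ N = wins σ N ÷ length (Av123 N)

-- number of left-to-right maxima (entries are ≥ 1)
lrmFrom : ℕ → List ℕ → ℕ
lrmFrom m []       = 0
lrmFrom m (x ∷ xs) = if m <ᵇ x then suc (lrmFrom x xs) else lrmFrom m xs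

numLRMax : List ℕ → ℕ
numLRMax = lrmFrom 0

lastIsLRMax : List ℕ → Bool
lastIsLRMax q with reverse q
... | []       = false
... | x ∷ rest = all (_<ᵇ x) rest

secondLRMax : Strategy
secondLRMax q = lastIsLRMax q ∧ (numLRMax q ≡ᵇ 2)

-- What may follow a prefix depends only on
-- its minimum t and its cap c, the least entry having a smaller one before it: later entries are
-- unused and below c, and no 12 may occur above t.  With a unused values below t and b between t
-- and c, the number of completions satisfies the ballot recursion, so Av_N(123) is counted by C_N
-- and the permutations with N in position k by the ballot number C(N-1, k-1).  As the entries
-- before N decrease, the prefix of size k ≥ 2 is the staircase exactly when N is in position k,
-- which yields the strike probabilities.  A strategy accepting the first candidate wins exactly
-- when N comes first; one rejecting it can only win when N comes later, which is exactly when the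
-- second left-to-right maximum is N.  Since C_N ≥ 2 C_(N-1) the latter is at least as likely, and
-- its probability 1 - C_(N-1)/C_N tends to 3/4 because C_N/C_(N-1) = 2(2N-1)/(N+1).

module Submission where

open import Defs
open import Data.Bool using (Bool; true; false; _∧_; _∨_; not; if_then_else_)
open import Data.Bool.Properties using (∧-zeroʳ; ∧-identityʳ; ∧-assoc; ∧-idem; ∧-commutativeMonoid)
open import Data.Bool.ListAction using (any; all; or; and)
open import Algebra.Solver.CommutativeMonoid ∧-commutativeMonoid using (solve; _⊜_; _⊕_)
open import Data.Empty using (⊥; ⊥-elim)
open import Data.Fin using (Fin; zero; suc)
import Data.Integer as ℤ
import Data.Integer.Properties as ℤ
open import Data.List using (List; []; _∷_; [_]; _++_; _∷ʳ_; map; concatMap; upTo; applyUpTo; length; filterᵇ; take; allFin; lookup; findᵇ; reverse)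
open import Data.List.Membership.Propositional using (_∈_)
open import Data.List.Properties using (upTo-∷ʳ; map-++; map-tabulate; map-cong; ∷ʳ-injectiveʳ; ≡-dec; map-applyUpTo; reverse-++; unfold-reverse; ++-identityʳ; length-map)
open import Data.List.Relation.Unary.Any using (here; there)
open import Data.Maybe using (just; nothing; fromMaybe)
open import Data.Nat
open import Data.Nat.Combinatorics
open import Data.Nat.DivMod using (m*n/n≡m)
open import Data.Nat.ListAction using (sum)
open import Data.Nat.ListAction.Properties using (sum-++)
open import Data.Nat.Properties
open import Data.Nat.Tactic.RingSolver using (solve-∀)
open import Data.Product using (_×_; _,_; ∃; proj₁; proj₂)
import Data.Rational as ℚ
import Data.Rational.Properties as ℚ
import Data.Rational.Unnormalised as ℚᵘ
import Data.Rational.Unnormalised.Properties as ℚᵘ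
open import Data.Sum using (_⊎_; inj₁; inj₂)
open import Function using (_∘_; id)
open import Relation.Binary.Definitions using (tri<; tri≈; tri>)
open import Relation.Binary.PropositionalEquality hiding ([_])
open import Relation.Nullary using (¬_; yes; no)

-- Ballot numbers as counts of fills

pascal : ∀ n k → suc n C suc k ≡ n C k + n C suc k
pascal n k = sym (nCk+nC[k+1]≡[n+1]C[k+1] n k)

absorption : ∀ m k → suc k * (suc m C suc k) ≡ suc m * (m C k)
absorption zero zero = refl
absorption zero (suc k)
  rewrite k>n⇒nCk≡0 {1} {suc (suc k)} (s≤s (s≤s z≤n)) | k>n⇒nCk≡0 {0} {suc k} (s≤s z≤n) =
  *-zeroʳ (suc (suc k))
absorption (suc m) zero rewrite nC1≡n (suc (suc m)) | *-identityʳ (suc (suc m)) = +-identityʳ _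
absorption (suc m) (suc k) = begin
  suc (suc k) * (suc (suc m) C suc (suc k))            ≡⟨ cong (suc (suc k) *_) (pascal (suc m) (suc k)) ⟩
  suc (suc k) * (A + B)                                ≡⟨ split k A B ⟩
  suc k * A + A + suc (suc k) * B                      ≡⟨ cong₂ (λ u v → u + A + v) (absorption m k) (absorption m (suc k)) ⟩
  suc m * (m C k) + A + suc m * (m C suc k)            ≡⟨ regroup m (m C k) A (m C suc k) ⟩
  suc m * (m C k + m C suc k) + A                      ≡⟨ cong (λ u → suc m * u + A) (sym (pascal m k)) ⟩
  suc m * A + A                                        ≡⟨ +-comm (suc m * A) A ⟩
  suc (suc m) * A                                      ∎
  where
  open ≡-Reasoning
  A B : ℕ
  A = suc m C suc k
  B = suc m C suc (suc k)
  split : ∀ k A B → suc (suc k) * (A + B) ≡ suc k * A + A + suc (suc k) * B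
  split = solve-∀
  regroup : ∀ m x A y → suc m * x + A + suc m * y ≡ suc m * (x + y) + A
  regroup = solve-∀

sumBelow : ℕ → (ℕ → ℕ) → ℕ
sumBelow zero    f = 0
sumBelow (suc m) f = sumBelow m f + f m

sumBelow-cong : ∀ m {f g : ℕ → ℕ} → (∀ i → i < m → f i ≡ g i) → sumBelow m f ≡ sumBelow m g
sumBelow-cong zero    f≗g = refl
sumBelow-cong (suc m) f≗g = cong₂ _+_ (sumBelow-cong m (λ i i<m → f≗g i (m<n⇒m<1+n i<m))) (f≗g m ≤-refl)

sumBelow-zero : ∀ m {f : ℕ → ℕ} → (∀ i → i < m → f i ≡ 0) → sumBelow m f ≡ 0
sumBelow-zero zero    f≗0 = refl
sumBelow-zero (suc m) f≗0 = cong₂ _+_ (sumBelow-zero m (λ i i<m → f≗0 i (m<n⇒m<1+n i<m))) (f≗0 m ≤-refl)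

sumBelow-+ : ∀ j m (f : ℕ → ℕ) → sumBelow (j + m) f ≡ sumBelow j f + sumBelow m (λ i → f (j + i))
sumBelow-+ j zero    f rewrite +-identityʳ j = sym (+-identityʳ _)
sumBelow-+ j (suc m) f rewrite +-suc j m | sumBelow-+ j m f = +-assoc (sumBelow j f) _ _

-- fill n a b counts the ways to write n further entries of a 123-avoiding word when a unused
-- values lie below its current minimum and b unused values lie strictly between that minimum
-- and its cap, the least entry having a smaller one before it (they form "the band").  Writing
-- the i-th low value makes it the new minimum and the a - 1 - i low values above it join the
-- band; writing the j-th band value makes it the cap, leaving j values in the band.
fill : ℕ → ℕ → ℕ → ℕ
fill zero    a b = 1
fill (suc n) a b = sumBelow a (λ i → fill n i (b + (a ∸ suc i))) + sumBelow b (λ j → fill n a j)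

low-step-size : ∀ i a b → i < a → suc (i + (b + (a ∸ suc i))) ≡ a + b
low-step-size i a b i<a = begin
  suc (i + (b + (a ∸ suc i)))   ≡⟨ shuffle i b (a ∸ suc i) ⟩
  (suc i + (a ∸ suc i)) + b     ≡⟨ cong (_+ b) (m+[n∸m]≡n i<a) ⟩
  a + b                         ∎
  where
  open ≡-Reasoning
  shuffle : ∀ i b d → suc (i + (b + d)) ≡ (suc i + d) + b
  shuffle = solve-∀

fill-overfull : ∀ n a b → a + b < n → fill n a b ≡ 0
fill-overfull (suc n) a b a+b<n = cong₂ _+_
  (sumBelow-zero a (λ i i<a → fill-overfull n i _ (subst (_≤ n) (sym (low-step-size i a b i<a)) (≤-pred a+b<n))))
  (sumBelow-zero b (λ j j<b → fill-overfull n a j (≤-trans (+-monoʳ-< a j<b) (≤-pred a+b<n))))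

complete : ℕ → ℕ → ℕ
complete a b = fill (a + b) a b

complete-zeroˡ : ∀ b → complete 0 b ≡ 1
complete-zeroˡ zero    = refl
complete-zeroˡ (suc b) = cong₂ _+_ (sumBelow-zero b (λ j j<b → fill-overfull b 0 j j<b)) (complete-zeroˡ b)

private
  lowSum : ℕ → ℕ → ℕ
  lowSum a b = sumBelow a (λ i → fill (a + b) i (suc b + (a ∸ suc i)))

  complete-sucʳ : ∀ a b → complete a (suc b) ≡ lowSum a b + complete a b
  complete-sucʳ a b rewrite +-suc a b =
    cong (lowSum a b +_) (cong (_+ complete a b) (sumBelow-zero b (λ j j<b → fill-overfull (a + b) a j (+-monoʳ-< a j<b))))

  complete-sucˡ : ∀ a b → complete (suc a) b ≡ (lowSum a b + complete a b) + sumBelow b (λ j → fill (a + b) (suc a) j)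
  complete-sucˡ a b = cong (_+ sumBelow b (λ j → fill (a + b) (suc a) j))
    (cong₂ _+_ (sumBelow-cong a (λ i i<a → cong (fill (a + b) i) (shift i i<a)))
               (cong (fill (a + b) a) (trans (cong (b +_) (n∸n≡0 a)) (+-identityʳ b))))
    where
    shift : ∀ i → i < a → b + (a ∸ i) ≡ suc b + (a ∸ suc i)
    shift i i<a = trans (cong (b +_) (+-∸-assoc 1 i<a)) (+-suc b (a ∸ suc i))

complete-suc-zero : ∀ a → complete (suc a) 0 ≡ complete a 1
complete-suc-zero a = trans (complete-sucˡ a 0) (trans (+-identityʳ _) (sym (complete-sucʳ a 0)))

complete-suc-suc : ∀ a b → complete (suc a) (suc b) ≡ complete a (suc (suc b)) + complete (suc a) b
complete-suc-suc a b = begin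
  complete (suc a) (suc b)                                                  ≡⟨ complete-sucˡ a (suc b) ⟩
  (lowSum a (suc b) + complete a (suc b)) + sumBelow (suc b) (fill (a + suc b) (suc a))
    ≡⟨ cong ((lowSum a (suc b) + complete a (suc b)) +_) bandSum ⟩
  (lowSum a (suc b) + complete a (suc b)) + complete (suc a) b              ≡⟨ cong (_+ complete (suc a) b) (sym (complete-sucʳ a (suc b))) ⟩
  complete a (suc (suc b)) + complete (suc a) b                             ∎
  where
  open ≡-Reasoning
  bandSum : sumBelow (suc b) (fill (a + suc b) (suc a)) ≡ complete (suc a) b
  bandSum = cong₂ _+_
    (sumBelow-zero b (λ j j<b → fill-overfull (a + suc b) (suc a) j
      (subst (suc a + j <_) (sym (+-suc a b)) (s≤s (+-monoʳ-< a j<b)))))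
    (cong (λ n → fill n (suc a) b) (+-suc a b))

-- The two binomial steps of Pascal's rule mirroring the recursions of complete; the second uses
-- the symmetry of the central binomial coefficients.
private
  pascal-step : ∀ m k {x y z} → x ≡ y + z → y + m C (3 + k) ≡ m C (2 + k) → z + m C (2 + k) ≡ m C (1 + k) →
    x + suc m C (3 + k) ≡ suc m C (2 + k)
  pascal-step m k {x} {y} {z} refl hy hz = begin
    (y + z) + suc m C (3 + k)                ≡⟨ cong ((y + z) +_) (pascal m (2 + k)) ⟩
    (y + z) + (m C (2 + k) + m C (3 + k))    ≡⟨ regroup y z (m C (2 + k)) (m C (3 + k)) ⟩
    (y + m C (3 + k)) + (z + m C (2 + k))    ≡⟨ cong₂ _+_ hy hz ⟩
    m C (2 + k) + m C (1 + k)                ≡⟨ +-comm (m C (2 + k)) _ ⟩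
    m C (1 + k) + m C (2 + k)                ≡⟨ sym (pascal m (1 + k)) ⟩
    suc m C (2 + k)                          ∎
    where
    open ≡-Reasoning
    regroup : ∀ y z A B → (y + z) + (A + B) ≡ (y + B) + (z + A)
    regroup = solve-∀

  pascal-step-central : ∀ a {x y} → x ≡ y → y + (a + a + 1) C (2 + a) ≡ (a + a + 1) C (1 + a) →
    x + suc (a + a + 1) C (2 + a) ≡ suc (a + a + 1) C (1 + a)
  pascal-step-central a {x} refl hy = begin
    x + suc m C (2 + a)                ≡⟨ cong (x +_) (pascal m (1 + a)) ⟩
    x + (m C (1 + a) + m C (2 + a))    ≡⟨ regroup x (m C (1 + a)) (m C (2 + a)) ⟩
    (x + m C (2 + a)) + m C (1 + a)    ≡⟨ cong (_+ m C (1 + a)) hy ⟩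
    m C (1 + a) + m C (1 + a)          ≡⟨ cong (_+ m C (1 + a)) (sym symmetric) ⟩
    m C a + m C (1 + a)                ≡⟨ sym (pascal m a) ⟩
    suc m C (1 + a)                    ∎
    where
    open ≡-Reasoning
    m : ℕ
    m = a + a + 1
    regroup : ∀ x A B → x + (A + B) ≡ (x + B) + A
    regroup = solve-∀
    m∸a : m ∸ a ≡ suc a
    m∸a = trans (cong (_∸ a) (reassoc a)) (m+n∸m≡n a (suc a))
      where
      reassoc : ∀ a → a + a + 1 ≡ a + suc a
      reassoc = solve-∀
    symmetric : m C a ≡ m C (1 + a)
    symmetric = trans (nCk≡nC[n∸k] (≤-trans (m≤m+n a a) (m≤m+n (a + a) 1))) (cong (m C_) m∸a)

  reindex : ∀ {x m m′ k k′} → m ≡ m′ → k ≡ k′ → x + m C suc k ≡ m C k → x + m′ C suc k′ ≡ m′ C k′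
  reindex refl refl h = h

complete+binomial : ∀ a b → complete a b + (a + a + b) C suc (a + b) ≡ (a + a + b) C (a + b)
complete+binomial zero b rewrite complete-zeroˡ b | k>n⇒nCk≡0 {b} {suc b} ≤-refl | nCn≡1 b = refl
complete+binomial (suc a) zero =
  reindex (reassoc a) (sym (+-identityʳ (suc a)))
    (pascal-step-central a (complete-suc-zero a)
      (reindex refl (trans (+-suc a 0) (cong suc (+-identityʳ a))) (complete+binomial a 1)))
  where
  reassoc : ∀ a → suc (a + a + 1) ≡ suc a + suc a + 0
  reassoc = solve-∀
complete+binomial (suc a) (suc b) =
  reindex (reassoc₁ a b) (cong suc (sym (+-suc a b)))
    (pascal-step (a + a + suc (suc b)) (a + b) (complete-suc-suc a b)
      (reindex refl (reassoc₂ a b) (complete+binomial a (suc (suc b))))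
      (reindex (reassoc₃ a b) refl (complete+binomial (suc a) b)))
  where
  reassoc₁ : ∀ a b → suc (a + a + suc (suc b)) ≡ suc a + suc a + suc b
  reassoc₁ = solve-∀
  reassoc₂ : ∀ a b → a + suc (suc b) ≡ suc (suc (a + b))
  reassoc₂ = solve-∀
  reassoc₃ : ∀ a b → suc a + suc a + b ≡ a + a + suc (suc b)
  reassoc₃ = solve-∀

-- With A = m C n and B = m C (n+1) for m = 2n - k, absorption gives (n+1)(A + B) = (m+1) A, while
-- (n+1)(X + B) = (n+1) A; subtracting, (n+1) X = (2n + 2 - (m + 1)) A = (k + 1) A.
binomial-difference-scaled : ∀ n k X → k ≤ n → X + (2 * n ∸ k) C suc n ≡ (2 * n ∸ k) C n →
  suc n * X ≡ suc k * ((2 * n ∸ k) C n)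
binomial-difference-scaled n k X k≤n hyp = +-cancelʳ-≡ (suc n * B + suc n * A) _ _ (begin
  suc n * X + (suc n * B + suc n * A)     ≡⟨ sym (+-assoc (suc n * X) _ _) ⟩
  (suc n * X + suc n * B) + suc n * A     ≡⟨ cong (_+ suc n * A) withX ⟩
  suc n * A + suc n * A                   ≡⟨ double n m k A m+k≡n+n ⟩
  suc m * A + suc k * A                   ≡⟨ cong (_+ suc k * A) (sym withA) ⟩
  (suc n * A + suc n * B) + suc k * A     ≡⟨ rotate (suc n * A) (suc n * B) (suc k * A) ⟩
  suc k * A + (suc n * B + suc n * A)     ∎)
  where
  open ≡-Reasoning
  m A B : ℕ
  m = 2 * n ∸ k
  A = m C n
  B = m C suc n
  m+k≡n+n : m + k ≡ n + n
  m+k≡n+n = trans (m∸n+n≡m (≤-trans k≤n (≤-trans (m≤m+n n n) (≤-reflexive (cong (n +_) (sym (+-identityʳ n)))))))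
                  (cong (n +_) (+-identityʳ n))
  withA : suc n * A + suc n * B ≡ suc m * A
  withA = trans (sym (*-distribˡ-+ (suc n) A B)) (trans (cong (suc n *_) (sym (pascal m n))) (absorption m n))
  withX : suc n * X + suc n * B ≡ suc n * A
  withX = trans (sym (*-distribˡ-+ (suc n) X B)) (cong (suc n *_) hyp)
  double : ∀ n m k A → m + k ≡ n + n → suc n * A + suc n * A ≡ suc m * A + suc k * A
  double n m k A e = trans (lhs n A) (trans (cong (λ s → suc (suc s) * A) (sym e)) (rhs m k A))
    where
    lhs : ∀ n A → suc n * A + suc n * A ≡ suc (suc (n + n)) * A
    lhs = solve-∀
    rhs : ∀ m k A → suc (suc (m + k)) * A ≡ suc m * A + suc k * A
    rhs = solve-∀
  rotate : ∀ x y z → (x + y) + z ≡ z + (y + x)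
  rotate = solve-∀

ballot-from-binomial-difference : ∀ n k X → k ≤ n → X + (2 * n ∸ k) C suc n ≡ (2 * n ∸ k) C n → ballot n k ≡ X
ballot-from-binomial-difference n k X k≤n hyp = begin
  (suc k * ((2 * n ∸ k) C n)) / suc n    ≡⟨ cong (_/ suc n) (sym (binomial-difference-scaled n k X k≤n hyp)) ⟩
  (suc n * X) / suc n                    ≡⟨ cong (_/ suc n) (*-comm (suc n) X) ⟩
  (X * suc n) / suc n                    ≡⟨ m*n/n≡m X (suc n) ⟩
  X                                      ∎
  where open ≡-Reasoning

ballot≡complete : ∀ a b → ballot (a + b) b ≡ complete a b
ballot≡complete a b = ballot-from-binomial-difference (a + b) b (complete a b) (m≤n+m b a)
  (subst (λ m → complete a b + m C suc (a + b) ≡ m C (a + b)) (sym m≡) (complete+binomial a b))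
  where
  m≡ : 2 * (a + b) ∸ b ≡ a + a + b
  m≡ = trans (cong (_∸ b) (reassoc a b)) (m+n∸n≡m (a + a + b) b)
    where
    reassoc : ∀ a b → 2 * (a + b) ≡ a + a + b + b
    reassoc = solve-∀

ballot≡complete-∸ : ∀ n k → k ≤ n → ballot n k ≡ complete (n ∸ k) k
ballot≡complete-∸ n k k≤n = subst (λ n′ → ballot n′ k ≡ complete (n ∸ k) k) (m∸n+n≡m k≤n) (ballot≡complete (n ∸ k) k)

catalan≡complete : ∀ n → catalan n ≡ complete n 0
catalan≡complete n = trans (cong (_/ suc n) (sym (*-identityˡ ((2 * n) C n))))
  (subst (λ n′ → ballot n′ 0 ≡ complete n 0) (+-identityʳ n) (ballot≡complete n 0))

catalan-binomial : ∀ n → suc n * catalan n ≡ (2 * n) C n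
catalan-binomial n = trans (binomial-difference-scaled n 0 (catalan n) z≤n difference) (*-identityˡ _)
  where
  m≡ : n + n + 0 ≡ 2 * n
  m≡ = trans (+-identityʳ (n + n)) (cong (n +_) (sym (+-identityʳ n)))
  difference : catalan n + (2 * n) C suc n ≡ (2 * n) C n
  difference rewrite catalan≡complete n =
    subst₂ (λ m k → complete n 0 + m C suc k ≡ m C k) m≡ (+-identityʳ n) (complete+binomial n 0)

catalan-suc : ∀ M → suc (suc M) * catalan (suc M) ≡ 2 * suc (2 * M) * catalan M
catalan-suc M = *-cancelˡ-≡ _ _ (suc M * suc M) (begin
  suc M * suc M * (suc (suc M) * catalan (suc M))   ≡⟨ cong (suc M * suc M *_) (catalan-binomial (suc M)) ⟩
  suc M * suc M * (2 * suc M C suc M)               ≡⟨ cong (λ m → suc M * suc M * (m C suc M)) (double-suc M) ⟩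
  suc M * suc M * (suc m C suc M)                   ≡⟨ *-assoc (suc M) (suc M) _ ⟩
  suc M * (suc M * (suc m C suc M))                 ≡⟨ cong (suc M *_) (absorption m M) ⟩
  suc M * (suc m * (m C M))                         ≡⟨ swap (suc M) (suc m) (m C M) ⟩
  suc m * (suc M * (m C M))                         ≡⟨ cong (λ x → suc m * (suc M * x)) central-symmetry ⟩
  suc m * (suc M * (m C suc M))                     ≡⟨ cong (suc m *_) (absorption (2 * M) M) ⟩
  suc m * (m * ((2 * M) C M))                       ≡⟨ cong (λ x → suc m * (m * x)) (sym (catalan-binomial M)) ⟩
  suc m * (m * (suc M * catalan M))                 ≡⟨ regroup M (catalan M) ⟩
  suc M * suc M * (2 * suc (2 * M) * catalan M)     ∎)
  where
  open ≡-Reasoning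
  m : ℕ
  m = suc (2 * M)
  double-suc : ∀ M → 2 * suc M ≡ suc (suc (2 * M))
  double-suc = solve-∀
  swap : ∀ x y z → x * (y * z) ≡ y * (x * z)
  swap = solve-∀
  regroup : ∀ M c → suc (suc (2 * M)) * (suc (2 * M) * (suc M * c)) ≡ suc M * suc M * (2 * suc (2 * M) * c)
  regroup = solve-∀
  m∸M : m ∸ M ≡ suc M
  m∸M = trans (cong (_∸ M) (reassoc M)) (m+n∸m≡n M (suc M))
    where
    reassoc : ∀ M → suc (2 * M) ≡ M + suc M
    reassoc = solve-∀
  central-symmetry : m C M ≡ m C suc M
  central-symmetry = trans (nCk≡nC[n∸k] (≤-trans (m≤n+m M M) (≤-trans (≤-reflexive (cong (M +_) (sym (+-identityʳ M)))) (n≤1+n _))))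
                           (cong (m C_) m∸M)

complete-pos : ∀ a b → 1 ≤ complete a b
complete-pos zero    b       = ≤-reflexive (sym (complete-zeroˡ b))
complete-pos (suc a) zero    = subst (1 ≤_) (sym (complete-suc-zero a)) (complete-pos a 1)
complete-pos (suc a) (suc b) = subst (1 ≤_) (sym (complete-suc-suc a b)) (≤-trans (complete-pos a (suc (suc b))) (m≤m+n _ _))

catalan-pos : ∀ n → 1 ≤ catalan n
catalan-pos n = subst (1 ≤_) (sym (catalan≡complete n)) (complete-pos n 0)

catalan-doubling : ∀ M → 1 ≤ M → 2 * catalan M ≤ catalan (suc M)
catalan-doubling M 1≤M = *-cancelˡ-≤ (suc (suc M)) (begin
  suc (suc M) * (2 * catalan M)     ≡⟨ swap (suc (suc M)) 2 (catalan M) ⟩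
  2 * suc (suc M) * catalan M       ≤⟨ *-monoˡ-≤ (catalan M) (*-monoʳ-≤ 2 M+2≤2M+1) ⟩
  2 * suc (2 * M) * catalan M       ≡⟨ sym (catalan-suc M) ⟩
  suc (suc M) * catalan (suc M)     ∎)
  where
  open ≤-Reasoning
  swap : ∀ x y z → x * (y * z) ≡ y * x * z
  swap = solve-∀
  M+2≤2M+1 : suc (suc M) ≤ suc (2 * M)
  M+2≤2M+1 = s≤s (subst (suc M ≤_) (cong (M +_) (sym (+-identityʳ M))) (subst (_≤ M + M) (+-comm M 1) (+-monoʳ-≤ M 1≤M)))

-- fillTop n a b j counts the fills of fill n a b whose step j (counting from 0) writes the largest
-- unused value, the top of the band if b > 0 and otherwise the top low value.  Before that step
-- only low values other than the top one may be written: a band value would cap the word below it.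
fillTop : ℕ → ℕ → ℕ → ℕ → ℕ
fillTop zero    a       b       j       = 0
fillTop (suc n) a       zero    (suc j) = sumBelow (a ∸ 1) (λ i → fillTop n i (a ∸ suc i) j)
fillTop (suc n) a       (suc b) (suc j) = sumBelow a (λ i → fillTop n i (suc b + (a ∸ suc i)) j)
fillTop (suc n) a       (suc b) zero    = fill n a b
fillTop (suc n) zero    zero    zero    = 0
fillTop (suc n) (suc a) zero    zero    = fill n a 0

complete-suc-as-sum : ∀ a b → sumBelow (suc a) (λ i → complete i (b + (suc a ∸ suc i))) ≡ complete a (suc b)
complete-suc-as-sum a zero = begin
  sumBelow (suc a) (λ i → complete i (a ∸ i))
    ≡⟨ sumBelow-cong (suc a) (λ i i≤a → cong (λ n → fill n i (a ∸ i)) (m+[n∸m]≡n (≤-pred i≤a))) ⟩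
  sumBelow (suc a) (λ i → fill a i (suc a ∸ suc i))   ≡⟨ sym (+-identityʳ _) ⟩
  fill (suc a) (suc a) 0                              ≡⟨ cong (λ n → fill n (suc a) 0) (sym (+-identityʳ (suc a))) ⟩
  complete (suc a) 0                                  ≡⟨ complete-suc-zero a ⟩
  complete a 1                                        ∎
  where open ≡-Reasoning
complete-suc-as-sum a (suc b) = +-cancelʳ-≡ (complete (suc a) b) _ _ (begin
  sumBelow (suc a) (λ i → complete i (suc b + (suc a ∸ suc i))) + complete (suc a) b
    ≡⟨ cong (_+ complete (suc a) b) (sumBelow-cong (suc a) (λ i i≤a → cong (λ n → fill n i (suc b + (a ∸ i))) (size i i≤a))) ⟩
  sumBelow (suc a) (λ i → fill (suc a + b) i (suc b + (suc a ∸ suc i))) + complete (suc a) b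
    ≡⟨ sym (complete-sucʳ (suc a) b) ⟩
  complete (suc a) (suc b)                                  ≡⟨ complete-suc-suc a b ⟩
  complete a (suc (suc b)) + complete (suc a) b             ∎)
  where
  open ≡-Reasoning
  size : ∀ i → i < suc a → i + (suc b + (a ∸ i)) ≡ suc a + b
  size i i≤a = trans (shuffle i b (a ∸ i)) (cong (λ s → suc s + b) (m+[n∸m]≡n (≤-pred i≤a)))
    where
    shuffle : ∀ i b d → i + (suc b + d) ≡ suc (i + d) + b
    shuffle = solve-∀

private
  size-after-low : ∀ {n a b} → suc n ≡ a + suc b → ∀ i → i < a → n ≡ i + suc (b + (a ∸ suc i))
  size-after-low {a = a} {b} e i i<a =
    trans (suc-injective (trans e (+-suc a b))) (sym (trans (+-suc i _) (low-step-size i a b i<a)))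

  reindex-low : ∀ {a b j} → a ≡ j + suc (a ∸ suc j) → ∀ i → i < suc (a ∸ suc j) →
    b + (a ∸ suc (j + i)) + j ≡ (b + j) + (suc (a ∸ suc j) ∸ suc i)
  reindex-low {a} {b} {j} a≡ i _ = begin
    b + (a ∸ suc (j + i)) + j                        ≡⟨ cong (λ x → b + (x ∸ suc (j + i)) + j) a≡ ⟩
    b + ((j + suc r) ∸ suc (j + i)) + j              ≡⟨ cong (λ x → b + (j + suc r ∸ x) + j) (sym (+-suc j i)) ⟩
    b + ((j + suc r) ∸ (j + suc i)) + j              ≡⟨ cong (λ x → b + x + j) ([m+n]∸[m+o]≡n∸o j (suc r) (suc i)) ⟩
    b + (suc r ∸ suc i) + j                          ≡⟨ swap b (suc r ∸ suc i) j ⟩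
    (b + j) + (suc r ∸ suc i)                        ∎
    where
    open ≡-Reasoning
    r : ℕ
    r = a ∸ suc j
    swap : ∀ b x j → b + x + j ≡ (b + j) + x
    swap = solve-∀

fillTop-too-late : ∀ j a b n → n ≡ a + suc b → a < j → fillTop n a (suc b) j ≡ 0
fillTop-too-late (suc j) a b (suc n) e a<j =
  sumBelow-zero a (λ i i<a → fillTop-too-late j i _ n (size-after-low e i i<a) (≤-trans i<a (≤-pred a<j)))
fillTop-too-late (suc j) a b zero    e a<j = refl

fillTop-in-time : ∀ j a b n → n ≡ a + suc b → j ≤ a → fillTop n a (suc b) j ≡ complete (a ∸ j) (b + j)
fillTop-in-time zero    a b (suc n) e z≤n rewrite +-identityʳ b | suc-injective (trans e (+-suc a b)) = refl
fillTop-in-time zero    a b zero    e z≤n with () ← trans e (+-suc a b)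
fillTop-in-time (suc j) a b zero    e j<a with () ← trans e (+-suc a b)
fillTop-in-time (suc j) a b (suc n) e j<a = begin
  sumBelow a φ                                         ≡⟨ cong (λ m → sumBelow m φ) a≡ ⟩
  sumBelow (j + suc r) φ                               ≡⟨ sumBelow-+ j (suc r) φ ⟩
  sumBelow j φ + sumBelow (suc r) (λ i → φ (j + i))
    ≡⟨ cong₂ _+_ (sumBelow-zero j (λ i i<j → fillTop-too-late j i _ n (size-after-low e i (<-trans i<j j<a)) i<j))
                 (sumBelow-cong (suc r) (λ i i≤r →
                   trans (fillTop-in-time j (j + i) _ n (size-after-low e (j + i) (shifted i i≤r)) (m≤m+n j i))
                         (cong₂ complete (m+n∸m≡n j i) (reindex-low a≡ i i≤r)))) ⟩
  0 + sumBelow (suc r) (λ i → complete i ((b + j) + (suc r ∸ suc i)))  ≡⟨ complete-suc-as-sum r (b + j) ⟩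
  complete r (suc (b + j))                             ≡⟨ cong (complete r) (sym (+-suc b j)) ⟩
  complete (a ∸ suc j) (b + suc j)                     ∎
  where
  open ≡-Reasoning
  r : ℕ
  r = a ∸ suc j
  φ : ℕ → ℕ
  φ i = fillTop n i (suc (b + (a ∸ suc i))) j
  a≡ : a ≡ j + suc r
  a≡ = sym (trans (+-suc j r) (m+[n∸m]≡n j<a))
  shifted : ∀ i → i < suc r → j + i < a
  shifted i i≤r = subst (j + i <_) (sym a≡) (+-monoʳ-< j i≤r)

fillTop-from-start : ∀ n j → j ≤ n → fillTop (suc n) (suc n) 0 j ≡ complete (n ∸ j) j
fillTop-from-start n zero    z≤n = cong (λ m → fill m n 0) (sym (+-identityʳ n))
fillTop-from-start n (suc j) j<n =
  trans (sumBelow-cong n (λ i i<n → cong (λ b → fillTop n i b j) (+-∸-assoc 1 i<n)))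
        (fillTop-in-time (suc j) n 0 (suc n) (+-comm 1 n) j<n)

indicator : Bool → ℕ
indicator true  = 1
indicator false = 0

module _ {A : Set} where

  count-∷ : ∀ (p : A → Bool) x xs → count p (x ∷ xs) ≡ indicator (p x) + count p xs
  count-∷ p x xs with p x
  ... | true  = refl
  ... | false = refl

  count-++ : ∀ (p : A → Bool) xs ys → count p (xs ++ ys) ≡ count p xs + count p ys
  count-++ p []       ys = refl
  count-++ p (x ∷ xs) ys rewrite count-∷ p x (xs ++ ys) | count-∷ p x xs | count-++ p xs ys =
    sym (+-assoc (indicator (p x)) _ _)

  count-cong : ∀ {p q : A → Bool} xs → (∀ x → p x ≡ q x) → count p xs ≡ count q xs
  count-cong []       p≗q = refl
  count-cong {p} {q} (x ∷ xs) p≗q rewrite count-∷ p x xs | count-∷ q x xs | p≗q x | count-cong xs p≗q = refl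

  count-false : ∀ xs → count (λ (_ : A) → false) xs ≡ 0
  count-false []       = refl
  count-false (x ∷ xs) = count-false xs

  count-guard : ∀ (b : Bool) (q : A → Bool) xs → count (λ x → b ∧ q x) xs ≡ (if b then count q xs else 0)
  count-guard true  q xs = refl
  count-guard false q xs = count-false xs

  count-filterᵇ : ∀ (p q : A → Bool) xs → count q (filterᵇ p xs) ≡ count (λ x → p x ∧ q x) xs
  count-filterᵇ p q []       = refl
  count-filterᵇ p q (x ∷ xs) =
    trans step (trans (cong (indicator (p x ∧ q x) +_) (count-filterᵇ p q xs)) (sym (count-∷ _ x xs)))
    where
    step : count q (filterᵇ p (x ∷ xs)) ≡ indicator (p x ∧ q x) + count q (filterᵇ p xs)
    step with p x
    ... | true  = count-∷ q x _
    ... | false = refl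

  length≡count-true : ∀ xs → length xs ≡ count (λ (_ : A) → true) xs
  length≡count-true []       = refl
  length≡count-true (x ∷ xs) = cong suc (length≡count-true xs)

  count-mono : ∀ {p q : A → Bool} xs → (∀ x → p x ≡ true → q x ≡ true) → count p xs ≤ count q xs
  count-mono []       p⇒q = z≤n
  count-mono {p} {q} (x ∷ xs) p⇒q rewrite count-∷ p x xs | count-∷ q x xs with p x in px
  ... | true rewrite p⇒q x px = s≤s (count-mono xs p⇒q)
  ... | false = ≤-trans (count-mono xs p⇒q) (m≤n+m _ (indicator (q x)))

  count+count-not : ∀ (p : A → Bool) xs → count p xs + count (λ x → not (p x)) xs ≡ length xs
  count+count-not p []       = refl
  count+count-not p (x ∷ xs) rewrite count-∷ p x xs | count-∷ (λ x → not (p x)) x xs with p x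
  ... | true  = cong suc (count+count-not p xs)
  ... | false = trans (+-suc _ _) (cong suc (count+count-not p xs))

module _ {A B : Set} where

  count-map : ∀ (p : B → Bool) (h : A → B) xs → count p (map h xs) ≡ count (λ x → p (h x)) xs
  count-map p h []       = refl
  count-map p h (x ∷ xs) rewrite count-∷ p (h x) (map h xs) | count-∷ (λ x → p (h x)) x xs | count-map p h xs = refl

  count-concatMap : ∀ (p : B → Bool) (g : A → List B) xs → count p (concatMap g xs) ≡ sum (map (λ x → count p (g x)) xs)
  count-concatMap p g []       = refl
  count-concatMap p g (x ∷ xs) = trans (count-++ p (g x) (concatMap g xs)) (cong (count p (g x) +_) (count-concatMap p g xs))

sumValues : ℕ → (ℕ → ℕ) → ℕ
sumValues zero    g = 0
sumValues (suc m) g = sumValues m g + g (suc m)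

sumValues-cong : ∀ m {g h : ℕ → ℕ} → (∀ y → 1 ≤ y → y ≤ m → g y ≡ h y) → sumValues m g ≡ sumValues m h
sumValues-cong zero    g≗h = refl
sumValues-cong (suc m) g≗h = cong₂ _+_ (sumValues-cong m (λ y 1≤y y≤m → g≗h y 1≤y (m≤n⇒m≤1+n y≤m))) (g≗h (suc m) (s≤s z≤n) ≤-refl)

sumValues-zero : ∀ m → sumValues m (λ _ → 0) ≡ 0
sumValues-zero zero    = refl
sumValues-zero (suc m) = trans (+-identityʳ _) (sumValues-zero m)

sumValues-+ : ∀ m (g h : ℕ → ℕ) → sumValues m (λ y → g y + h y) ≡ sumValues m g + sumValues m h
sumValues-+ zero    g h = refl
sumValues-+ (suc m) g h rewrite sumValues-+ m g h = interchange (sumValues m g) (sumValues m h) (g (suc m)) (h (suc m))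
  where
  interchange : ∀ a b c d → a + b + (c + d) ≡ a + c + (b + d)
  interchange = solve-∀

sumValues-≤ : ∀ m (g : ℕ → ℕ) → (∀ y → g y ≤ 1) → sumValues m g ≤ m
sumValues-≤ zero    g g≤1 = z≤n
sumValues-≤ (suc m) g g≤1 = ≤-trans (+-mono-≤ (sumValues-≤ m g g≤1) (g≤1 (suc m))) (≤-reflexive (+-comm m 1))

sum-upTo≡sumValues : ∀ m (g : ℕ → ℕ) → sum (map g (map suc (upTo m))) ≡ sumValues m g
sum-upTo≡sumValues zero    g = refl
sum-upTo≡sumValues (suc m) g = begin
  sum (map g (map suc (upTo (suc m))))             ≡⟨ cong (λ l → sum (map g (map suc l))) (sym (upTo-∷ʳ m)) ⟩
  sum (map g (map suc (upTo m ∷ʳ m)))              ≡⟨ cong (λ l → sum (map g l)) (map-++ suc (upTo m) [ m ]) ⟩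
  sum (map g (map suc (upTo m) ++ [ suc m ]))      ≡⟨ cong sum (map-++ g (map suc (upTo m)) [ suc m ]) ⟩
  sum (map g (map suc (upTo m)) ++ [ g (suc m) ])  ≡⟨ sum-++ (map g (map suc (upTo m))) [ g (suc m) ] ⟩
  sum (map g (map suc (upTo m))) + (g (suc m) + 0) ≡⟨ cong₂ _+_ (sum-upTo≡sumValues m g) (+-identityʳ _) ⟩
  sumValues m g + g (suc m)                        ∎
  where open ≡-Reasoning

count-words-suc : ∀ m n (p : List ℕ → Bool) →
  count p (words m (suc n)) ≡ sumValues m (λ y → count (λ σ → p (y ∷ σ)) (words m n))
count-words-suc m n p = begin
  count p (words m (suc n))
    ≡⟨ count-concatMap p (λ x → map (x ∷_) (words m n)) (map suc (upTo m)) ⟩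
  sum (map (λ x → count p (map (x ∷_) (words m n))) (map suc (upTo m)))
    ≡⟨ cong sum (map-count-map (map suc (upTo m))) ⟩
  sum (map (λ y → count (λ σ → p (y ∷ σ)) (words m n)) (map suc (upTo m)))
    ≡⟨ sum-upTo≡sumValues m _ ⟩
  sumValues m (λ y → count (λ σ → p (y ∷ σ)) (words m n)) ∎
  where
  open ≡-Reasoning
  map-count-map : ∀ ys → map (λ x → count p (map (x ∷_) (words m n))) ys ≡ map (λ y → count (λ σ → p (y ∷ σ)) (words m n)) ys
  map-count-map []       = refl
  map-count-map (y ∷ ys) = cong₂ _∷_ (count-map p (y ∷_) (words m n)) (map-count-map ys)

<ᵇ-true : ∀ {m n} → m < n → (m <ᵇ n) ≡ true
<ᵇ-true {zero}  {suc n} _       = refl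
<ᵇ-true {suc m} {suc n} (s≤s p) = <ᵇ-true p

<ᵇ-false : ∀ {m n} → n ≤ m → (m <ᵇ n) ≡ false
<ᵇ-false {m}     {zero}  _       = refl
<ᵇ-false {suc m} {suc n} (s≤s p) = <ᵇ-false p

<ᵇ-sound : ∀ {m n} → (m <ᵇ n) ≡ true → m < n
<ᵇ-sound {zero}  {suc n} _ = s≤s z≤n
<ᵇ-sound {suc m} {suc n} e = s≤s (<ᵇ-sound e)

<ᵇ-irrefl : ∀ x → (x <ᵇ x) ≡ false
<ᵇ-irrefl x = <ᵇ-false {x} {x} ≤-refl

≡ᵇ-refl : ∀ m → (m ≡ᵇ m) ≡ true
≡ᵇ-refl zero    = refl
≡ᵇ-refl (suc m) = ≡ᵇ-refl m

≡ᵇ-false : ∀ {m n} → m ≢ n → (m ≡ᵇ n) ≡ false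
≡ᵇ-false {zero}  {zero}  m≢n = ⊥-elim (m≢n refl)
≡ᵇ-false {zero}  {suc n} m≢n = refl
≡ᵇ-false {suc m} {zero}  m≢n = refl
≡ᵇ-false {suc m} {suc n} m≢n = ≡ᵇ-false (m≢n ∘ cong suc)

≡ᵇ-sound : ∀ {m n} → (m ≡ᵇ n) ≡ true → m ≡ n
≡ᵇ-sound {zero}  {zero}  _ = refl
≡ᵇ-sound {suc m} {suc n} e = cong suc (≡ᵇ-sound e)

≡ᵇ-sym : ∀ m n → (m ≡ᵇ n) ≡ (n ≡ᵇ m)
≡ᵇ-sym zero    zero    = refl
≡ᵇ-sym zero    (suc n) = refl
≡ᵇ-sym (suc m) zero    = refl
≡ᵇ-sym (suc m) (suc n) = ≡ᵇ-sym m n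

false≢true : false ≢ true
false≢true ()

∧-elimˡ : ∀ {a b} → a ∧ b ≡ true → a ≡ true
∧-elimˡ {true} e = refl

∧-elimʳ : ∀ {a b} → a ∧ b ≡ true → b ≡ true
∧-elimʳ {true} e = e

∨-introˡ : ∀ {a} b → a ≡ true → a ∨ b ≡ true
∨-introˡ b refl = refl

∨-introʳ : ∀ a {b} → b ≡ true → a ∨ b ≡ true
∨-introʳ true  e = refl
∨-introʳ false e = e

∨-false : ∀ {a b} → a ∨ b ≡ false → (a ≡ false) × (b ≡ false)
∨-false {false} e = refl , e

if-true : ∀ {A : Set} {x y : A} b → b ≡ true → (if b then x else y) ≡ x
if-true true _ = refl

if-false : ∀ {A : Set} {x y : A} b → b ≡ false → (if b then x else y) ≡ y
if-false false _ = refl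

countValues : ℕ → (ℕ → Bool) → ℕ
countValues m S = sumValues m (λ y → indicator (S y))

countValues-cong : ∀ m (S T : ℕ → Bool) → (∀ z → 1 ≤ z → z ≤ m → S z ≡ T z) → countValues m S ≡ countValues m T
countValues-cong m S T S≗T = sumValues-cong m (λ z 1≤z z≤m → cong indicator (S≗T z 1≤z z≤m))

countValues-split : ∀ m (S T R : ℕ → Bool) → (∀ z → 1 ≤ z → z ≤ m → indicator (S z) ≡ indicator (T z) + indicator (R z)) →
  countValues m S ≡ countValues m T + countValues m R
countValues-split m S T R e = trans (sumValues-cong m e) (sumValues-+ m (indicator ∘ T) (indicator ∘ R))

countValues-all : ∀ m (S : ℕ → Bool) → (∀ z → 1 ≤ z → z ≤ m → S z ≡ true) → countValues m S ≡ m
countValues-all zero    S holds = refl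
countValues-all (suc m) S holds =
  trans (cong₂ _+_ (countValues-all m S (λ z 1≤z z≤m → holds z 1≤z (m≤n⇒m≤1+n z≤m))) (cong indicator (holds (suc m) (s≤s z≤n) ≤-refl)))
        (+-comm m 1)

countValues-none : ∀ m (S : ℕ → Bool) → (∀ z → 1 ≤ z → z ≤ m → S z ≡ false) → countValues m S ≡ 0
countValues-none m S none = trans (countValues-cong m S (λ _ → false) none) (sumValues-zero m)

countValues-single : ∀ m y → 1 ≤ y → y ≤ m → countValues m (λ z → y ≡ᵇ z) ≡ 1
countValues-single zero    (suc y) 1≤y ()
countValues-single (suc m) y 1≤y y≤m with m≤n⇒m<n∨m≡n y≤m
... | inj₂ refl = trans (cong₂ _+_ (countValues-none m _ (λ z _ z≤m → ≡ᵇ-false (λ e → <-irrefl (sym e) (s≤s z≤m))))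
                                   (cong indicator (≡ᵇ-refl (suc m))))
                        refl
... | inj₁ y<m  = trans (cong₂ _+_ (countValues-single m y 1≤y (≤-pred y<m)) (cong indicator (≡ᵇ-false (λ e → <-irrefl e y<m))))
                        refl

countValues-below : ∀ m (S : ℕ → Bool) y → 1 ≤ y → pred y ≤ m → countValues m (λ z → S z ∧ (z <ᵇ y)) ≡ countValues (pred y) S
countValues-below m S (suc y) _ y≤m with m≤n⇒m<n∨m≡n y≤m
... | inj₂ refl = countValues-cong y _ S (λ z _ z≤y → trans (cong (S z ∧_) (<ᵇ-true (s≤s z≤y))) (∧-identityʳ (S z)))
countValues-below (suc m) S (suc y) 1≤y _ | inj₁ y<m =
  trans (cong₂ _+_ (countValues-below m S (suc y) 1≤y (≤-pred y<m))
                   (cong indicator (trans (cong (S (suc m) ∧_) (<ᵇ-false {suc m} {suc y} y<m)) (∧-zeroʳ (S (suc m))))))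
        (+-identityʳ _)

sumValues-rank : ∀ m (S : ℕ → Bool) (φ : ℕ → ℕ) →
  sumValues m (λ y → if S y then φ (countValues (pred y) S) else 0) ≡ sumBelow (countValues m S) φ
sumValues-rank zero    S φ = refl
sumValues-rank (suc m) S φ with S (suc m)
... | true  = trans (cong (_+ φ (countValues m S)) (sumValues-rank m S φ)) (cong (λ n → sumBelow n φ) (+-comm 1 (countValues m S)))
... | false = trans (+-identityʳ _) (trans (sumValues-rank m S φ) (cong (λ n → sumBelow n φ) (sym (+-identityʳ (countValues m S)))))

elem : ℕ → List ℕ → Bool
elem x []      = false
elem x (y ∷ σ) = (x ≡ᵇ y) ∨ elem x σ

anyAbove : ℕ → List ℕ → Bool
anyAbove y []      = false
anyAbove y (z ∷ σ) = (y <ᵇ z) ∨ anyAbove y σ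

has12Above : ℕ → List ℕ → Bool
has12Above t []      = false
has12Above t (y ∷ σ) = ((t <ᵇ y) ∧ anyAbove y σ) ∨ has12Above t σ

allDistinct : List ℕ → Bool
allDistinct []      = true
allDistinct (x ∷ σ) = not (elem x σ) ∧ allDistinct σ

has123 : List ℕ → Bool
has123 []      = false
has123 (x ∷ σ) = has12Above x σ ∨ has123 σ

isAv123 : List ℕ → Bool
isAv123 []      = true
isAv123 (x ∷ σ) = not (elem x σ) ∧ not (has12Above x σ) ∧ isAv123 σ

private
  module _ {n : ℕ} where

    allFin-suc : ∀ {A : Set} (p : Fin (suc n) → A) → map p (allFin (suc n)) ≡ p zero ∷ map (p ∘ suc) (allFin n)
    allFin-suc p = cong (p zero ∷_) (trans (map-tabulate suc p) (sym (map-tabulate id (p ∘ suc))))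

    all-allFin-suc : ∀ (p : Fin (suc n) → Bool) → all p (allFin (suc n)) ≡ p zero ∧ all (p ∘ suc) (allFin n)
    all-allFin-suc p = cong and (allFin-suc p)

    any-allFin-suc : ∀ (p : Fin (suc n) → Bool) → any p (allFin (suc n)) ≡ p zero ∨ any (p ∘ suc) (allFin n)
    any-allFin-suc p = cong or (allFin-suc p)

    allFin-all-cong : ∀ {p q : Fin n → Bool} → (∀ i → p i ≡ q i) → all p (allFin n) ≡ all q (allFin n)
    allFin-all-cong p≗q = cong and (map-cong p≗q (allFin n))

    allFin-any-cong : ∀ {p q : Fin n → Bool} → (∀ i → p i ≡ q i) → any p (allFin n) ≡ any q (allFin n)
    allFin-any-cong p≗q = cong or (map-cong p≗q (allFin n))

    allFin-any-false : any (λ (_ : Fin n) → false) (allFin n) ≡ false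
    allFin-any-false = any-false′ (allFin n)
      where
      any-false′ : ∀ (is : List (Fin n)) → any (λ _ → false) is ≡ false
      any-false′ []       = refl
      any-false′ (_ ∷ is) = any-false′ is

    allFin-any-guard : ∀ b (p : Fin n → Bool) → any (λ i → b ∧ p i) (allFin n) ≡ b ∧ any p (allFin n)
    allFin-any-guard true  p = refl
    allFin-any-guard false p = allFin-any-false

  not-elem≡all : ∀ x ys → all (λ j → not (x ≡ᵇ lookup ys j)) (allFin (length ys)) ≡ not (elem x ys)
  not-elem≡all x []       = refl
  not-elem≡all x (y ∷ ys) rewrite all-allFin-suc (λ j → not (x ≡ᵇ lookup (y ∷ ys) j)) | not-elem≡all x ys with x ≡ᵇ y
  ... | true  = refl
  ... | false = refl

  anyAbove≡any : ∀ y zs → any (λ c → y <ᵇ lookup zs c) (allFin (length zs)) ≡ anyAbove y zs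
  anyAbove≡any y []       = refl
  anyAbove≡any y (z ∷ zs) = trans (any-allFin-suc (λ c → y <ᵇ lookup (z ∷ zs) c)) (cong ((y <ᵇ z) ∨_) (anyAbove≡any y zs))

  anyFin : (n : ℕ) → (Fin n → Bool) → Bool
  anyFin n p = any p (allFin n)

  pattern12 : ℕ → (xs : List ℕ) → Fin (length xs) → Fin (length xs) → Bool
  pattern12 t xs b c = (b <F c) ∧ (t <ᵇ lookup xs b) ∧ (lookup xs b <ᵇ lookup xs c)

  has12Above≡any : ∀ x ys → anyFin (length ys) (λ b → anyFin (length ys) (pattern12 x ys b)) ≡ has12Above x ys
  has12Above≡any x []       = refl
  has12Above≡any x (y ∷ zs) =
    trans (any-allFin-suc (λ b → anyFin (suc (length zs)) (pattern12 x (y ∷ zs) b)))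
      (cong₂ _∨_ (trans (any-allFin-suc (pattern12 x (y ∷ zs) zero))
                   (trans (allFin-any-guard (x <ᵇ y) (λ c → y <ᵇ lookup zs c)) (cong ((x <ᵇ y) ∧_) (anyAbove≡any y zs))))
                 (trans (allFin-any-cong (λ b → any-allFin-suc (pattern12 x (y ∷ zs) (suc b)))) (has12Above≡any x zs)))

private
  distinctPair : (xs : List ℕ) → Fin (length xs) → Fin (length xs) → Bool
  distinctPair xs i j = not (i <F j) ∨ not (lookup xs i ≡ᵇ lookup xs j)

distinct≡allDistinct : ∀ xs → distinct xs ≡ allDistinct xs
distinct≡allDistinct []       = refl
distinct≡allDistinct (x ∷ ys) = trans (all-allFin-suc (λ i → all (distinctPair (x ∷ ys) i) (allFin (suc (length ys)))))
  (cong₂ _∧_ (trans (all-allFin-suc (distinctPair (x ∷ ys) zero)) (not-elem≡all x ys))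
             (trans (allFin-all-cong (λ i → all-allFin-suc (distinctPair (x ∷ ys) (suc i)))) (distinct≡allDistinct ys)))

private
  pattern123 : (xs : List ℕ) → Fin (length xs) → Fin (length xs) → Fin (length xs) → Bool
  pattern123 xs a b c = (a <F b) ∧ (b <F c) ∧ (lookup xs a <ᵇ lookup xs b) ∧ (lookup xs b <ᵇ lookup xs c)

contains123≡has123 : ∀ xs → contains123 xs ≡ has123 xs
contains123≡has123 []       = refl
contains123≡has123 (x ∷ ys) =
  trans (any-allFin-suc (λ a → anyFin (suc n) (λ b → anyFin (suc n) (pattern123 (x ∷ ys) a b))))
        (cong₂ _∨_ firstAtHead (trans (allFin-any-cong firstLater) (contains123≡has123 ys)))
  where
  n : ℕ
  n = length ys
  firstAtHead : anyFin (suc n) (λ b → anyFin (suc n) (pattern123 (x ∷ ys) zero b)) ≡ has12Above x ys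
  firstAtHead = trans (any-allFin-suc (λ b → anyFin (suc n) (pattern123 (x ∷ ys) zero b)))
    (trans (cong (_∨ anyFin n (λ b → anyFin (suc n) (pattern123 (x ∷ ys) zero (suc b)))) (allFin-any-false {suc n}))
      (trans (allFin-any-cong (λ b → any-allFin-suc (pattern123 (x ∷ ys) zero (suc b)))) (has12Above≡any x ys)))
  firstLater : ∀ a → anyFin (suc n) (λ b → anyFin (suc n) (pattern123 (x ∷ ys) (suc a) b))
                   ≡ anyFin n (λ b → anyFin n (pattern123 ys a b))
  firstLater a = trans (any-allFin-suc (λ b → anyFin (suc n) (pattern123 (x ∷ ys) (suc a) b)))
    (trans (cong (_∨ anyFin n (λ b → anyFin (suc n) (pattern123 (x ∷ ys) (suc a) (suc b)))) (allFin-any-false {suc n}))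
      (allFin-any-cong (λ b → trans (any-allFin-suc (pattern123 (x ∷ ys) (suc a) (suc b)))
                                    (cong (_∨ anyFin n (pattern123 ys a b)) (∧-zeroʳ (a <F b))))))

distinct∧avoids≡isAv123 : ∀ π → distinct π ∧ not (contains123 π) ≡ isAv123 π
distinct∧avoids≡isAv123 π rewrite distinct≡allDistinct π | contains123≡has123 π = go π
  where
  go : ∀ π → allDistinct π ∧ not (has123 π) ≡ isAv123 π
  go []      = refl
  go (x ∷ σ) rewrite sym (go σ) with elem x σ | has12Above x σ
  ... | true  | _     = refl
  ... | false | true  = ∧-zeroʳ (allDistinct σ)
  ... | false | false = refl

-- Admissible continuations

not-∨ : ∀ a b → not (a ∨ b) ≡ not a ∧ not b
not-∨ true  b = refl
not-∨ false b = refl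

∨-true : ∀ {a b} → a ∨ b ≡ true → a ≡ true ⊎ b ≡ true
∨-true {true}  _ = inj₁ refl
∨-true {false} e = inj₂ e

not∧not-implied : ∀ {a b} → (b ≡ true → a ≡ true) → not a ∧ not b ≡ not a
not∧not-implied {true}          _   = refl
not∧not-implied {false} {false} _   = refl
not∧not-implied {false} {true}  b⇒a with () ← b⇒a refl

all-∧ : ∀ (p q : ℕ → Bool) σ → all (λ z → p z ∧ q z) σ ≡ all p σ ∧ all q σ
all-∧ p q []      = refl
all-∧ p q (z ∷ σ) rewrite all-∧ p q σ =
  solve 4 (λ a b c d → (a ⊕ b) ⊕ (c ⊕ d) ⊜ (a ⊕ c) ⊕ (b ⊕ d)) refl (p z) (q z) (all p σ) (all q σ)

all-cong : ∀ {p q : ℕ → Bool} σ → (∀ z → p z ≡ q z) → all p σ ≡ all q σ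
all-cong []      p≗q = refl
all-cong (z ∷ σ) p≗q = cong₂ _∧_ (p≗q z) (all-cong σ p≗q)

all-mono : ∀ {p q : ℕ → Bool} σ → (∀ z → p z ≡ true → q z ≡ true) → all p σ ≡ true → all q σ ≡ true
all-mono []      p⇒q _ = refl
all-mono (z ∷ σ) p⇒q a = cong₂ _∧_ (p⇒q z (∧-elimˡ a)) (all-mono σ p⇒q (∧-elimʳ a))

all-≢≡not-elem : ∀ y σ → all (λ z → not (y ≡ᵇ z)) σ ≡ not (elem y σ)
all-≢≡not-elem y []      = refl
all-≢≡not-elem y (z ∷ σ) rewrite all-≢≡not-elem y σ = sym (not-∨ (y ≡ᵇ z) (elem y σ))

all-≤≡not-anyAbove : ∀ y σ → all (λ z → not (y <ᵇ z)) σ ≡ not (anyAbove y σ)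
all-≤≡not-anyAbove y []      = refl
all-≤≡not-anyAbove y (z ∷ σ) rewrite all-≤≡not-anyAbove y σ = sym (not-∨ (y <ᵇ z) (anyAbove y σ))

has12Above-mono : ∀ {y t} σ → y < t → has12Above t σ ≡ true → has12Above y σ ≡ true
has12Above-mono {y} {t} (z ∷ σ) y<t h with ∨-true {(t <ᵇ z) ∧ anyAbove z σ} h
... | inj₁ atHead  = ∨-introˡ (has12Above y σ)
                     (cong₂ _∧_ (<ᵇ-true (<-trans y<t (<ᵇ-sound {t} {z} (∧-elimˡ atHead)))) (∧-elimʳ {t <ᵇ z} atHead))
... | inj₂ inTail = ∨-introʳ ((y <ᵇ z) ∧ anyAbove z σ) (has12Above-mono σ y<t inTail)

has12Above-needs-anyAbove : ∀ y σ → has12Above y σ ≡ true → anyAbove y σ ≡ true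
has12Above-needs-anyAbove y (z ∷ σ) h with ∨-true {(y <ᵇ z) ∧ anyAbove z σ} h
... | inj₁ atHead  = ∨-introˡ (anyAbove y σ) (∧-elimˡ {y <ᵇ z} atHead)
... | inj₂ inTail = ∨-introʳ (y <ᵇ z) (has12Above-needs-anyAbove y σ inTail)

fresh : (ℕ → Bool) → ℕ → ℕ → Bool
fresh U c z = not (U z) ∧ (z <ᵇ c)

extend : (ℕ → Bool) → ℕ → ℕ → Bool
extend U y z = U z ∨ (y ≡ᵇ z)

-- σ may follow a prefix with set of used values U, minimum t and cap c, the least entry having a
-- smaller one before it: its entries are unused and below c, and it has no 12 above t, which would
-- complete a 123 with t.
admissible : (ℕ → Bool) → ℕ → ℕ → List ℕ → Bool
admissible U t c σ = isAv123 σ ∧ all (fresh U c) σ ∧ not (has12Above t σ)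

fresh-extend : ∀ U c y z → fresh (extend U y) c z ≡ fresh U c z ∧ not (y ≡ᵇ z)
fresh-extend U c y z rewrite not-∨ (U z) (y ≡ᵇ z) =
  solve 3 (λ u e l → (u ⊕ e) ⊕ l ⊜ (u ⊕ l) ⊕ e) refl (not (U z)) (not (y ≡ᵇ z)) (z <ᵇ c)

all-fresh-extend : ∀ U c y σ → all (fresh (extend U y) c) σ ≡ all (fresh U c) σ ∧ not (elem y σ)
all-fresh-extend U c y σ rewrite all-cong σ (fresh-extend U c y) | all-∧ (fresh U c) (λ z → not (y ≡ᵇ z)) σ =
  cong (all (fresh U c) σ ∧_) (all-≢≡not-elem y σ)

below-lowered-cap : ∀ y c z → y < c → (z <ᵇ y) ∧ not (y ≡ᵇ z) ≡ ((z <ᵇ c) ∧ not (y <ᵇ z)) ∧ not (y ≡ᵇ z)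
below-lowered-cap y c z y<c with <-cmp z y
... | tri< z<y _ _ rewrite <ᵇ-true z<y | <ᵇ-true (<-trans z<y y<c) | <ᵇ-false {y} {z} (<⇒≤ z<y)
                         | ≡ᵇ-false {y} {z} (λ e → <-irrefl (sym e) z<y) = refl
... | tri≈ _ refl _ rewrite <ᵇ-irrefl z | <ᵇ-true y<c | ≡ᵇ-refl z = refl
... | tri> _ _ y<z rewrite <ᵇ-false {z} {y} (<⇒≤ y<z) | <ᵇ-true y<z | ∧-zeroʳ (z <ᵇ c) = refl

fresh-lowered : ∀ U c y z → y < c → fresh (extend U y) y z ≡ (fresh U c z ∧ not (y <ᵇ z)) ∧ not (y ≡ᵇ z)
fresh-lowered U c y z y<c = begin
  fresh (extend U y) y z                                     ≡⟨ fresh-extend U y y z ⟩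
  (not (U z) ∧ (z <ᵇ y)) ∧ not (y ≡ᵇ z)                      ≡⟨ ∧-assoc (not (U z)) _ _ ⟩
  not (U z) ∧ ((z <ᵇ y) ∧ not (y ≡ᵇ z))                      ≡⟨ cong (not (U z) ∧_) (below-lowered-cap y c z y<c) ⟩
  not (U z) ∧ (((z <ᵇ c) ∧ not (y <ᵇ z)) ∧ not (y ≡ᵇ z))     ≡⟨ reassoc (not (U z)) (z <ᵇ c) (not (y <ᵇ z)) (not (y ≡ᵇ z)) ⟩
  ((not (U z) ∧ (z <ᵇ c)) ∧ not (y <ᵇ z)) ∧ not (y ≡ᵇ z)     ∎
  where
  open ≡-Reasoning
  reassoc : ∀ u l a e → u ∧ ((l ∧ a) ∧ e) ≡ ((u ∧ l) ∧ a) ∧ e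
  reassoc = solve 4 (λ u l a e → u ⊕ ((l ⊕ a) ⊕ e) ⊜ ((u ⊕ l) ⊕ a) ⊕ e) refl

all-fresh-lowered : ∀ U c y σ → y < c →
  all (fresh (extend U y) y) σ ≡ (all (fresh U c) σ ∧ not (anyAbove y σ)) ∧ not (elem y σ)
all-fresh-lowered U c y σ y<c
  rewrite all-cong σ (λ z → fresh-lowered U c y z y<c)
        | all-∧ (λ z → fresh U c z ∧ not (y <ᵇ z)) (λ z → not (y ≡ᵇ z)) σ
        | all-∧ (fresh U c) (λ z → not (y <ᵇ z)) σ
        | all-≤≡not-anyAbove y σ | all-≢≡not-elem y σ = refl

admissible-∷-stale : ∀ U t c y σ → fresh U c y ≡ false → admissible U t c (y ∷ σ) ≡ false
admissible-∷-stale U t c y σ stale rewrite stale = ∧-zeroʳ (isAv123 (y ∷ σ))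

admissible-∷-low : ∀ U t c y σ → y < t → admissible U t c (y ∷ σ) ≡ fresh U c y ∧ admissible (extend U y) y c σ
admissible-∷-low U t c y σ y<t rewrite <ᵇ-false {t} {y} (<⇒≤ y<t) | all-fresh-extend U c y σ = begin
  (m ∧ h ∧ w) ∧ (u ∧ q) ∧ g     ≡⟨ solve 6 (λ m h w u q g → (m ⊕ h ⊕ w) ⊕ (u ⊕ q) ⊕ g ⊜ (h ⊕ g) ⊕ (m ⊕ w ⊕ u ⊕ q)) refl m h w u q g ⟩
  (h ∧ g) ∧ (m ∧ w ∧ u ∧ q)     ≡⟨ cong (_∧ (m ∧ w ∧ u ∧ q)) (not∧not-implied (has12Above-mono σ y<t)) ⟩
  h ∧ (m ∧ w ∧ u ∧ q)           ≡⟨ solve 5 (λ m h w u q → h ⊕ (m ⊕ w ⊕ u ⊕ q) ⊜ u ⊕ (w ⊕ (q ⊕ m) ⊕ h)) refl m h w u q ⟩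
  u ∧ (w ∧ (q ∧ m) ∧ h)         ∎
  where
  open ≡-Reasoning
  m h w u q g : Bool
  m = not (elem y σ)
  h = not (has12Above y σ)
  w = isAv123 σ
  u = fresh U c y
  q = all (fresh U c) σ
  g = not (has12Above t σ)

admissible-∷-band : ∀ U t c y σ → t < y → y < c → admissible U t c (y ∷ σ) ≡ fresh U c y ∧ admissible (extend U y) t y σ
admissible-∷-band U t c y σ t<y y<c
  rewrite <ᵇ-true t<y | not-∨ (anyAbove y σ) (has12Above t σ) | all-fresh-lowered U c y σ y<c = begin
  (m ∧ h ∧ w) ∧ (u ∧ q) ∧ (a ∧ g)   ≡⟨ solve 7 (λ m h w u q a g → (m ⊕ h ⊕ w) ⊕ (u ⊕ q) ⊕ (a ⊕ g) ⊜ (a ⊕ h) ⊕ (m ⊕ w ⊕ u ⊕ q ⊕ g)) refl m h w u q a g ⟩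
  (a ∧ h) ∧ (m ∧ w ∧ u ∧ q ∧ g)     ≡⟨ cong (_∧ (m ∧ w ∧ u ∧ q ∧ g)) (not∧not-implied (has12Above-needs-anyAbove y σ)) ⟩
  a ∧ (m ∧ w ∧ u ∧ q ∧ g)           ≡⟨ solve 6 (λ m w u q a g → a ⊕ (m ⊕ w ⊕ u ⊕ q ⊕ g) ⊜ u ⊕ (w ⊕ ((q ⊕ a) ⊕ m) ⊕ g)) refl m w u q a g ⟩
  u ∧ (w ∧ ((q ∧ a) ∧ m) ∧ g)       ∎
  where
  open ≡-Reasoning
  m h w u q a g : Bool
  m = not (elem y σ)
  h = not (has12Above y σ)
  w = isAv123 σ
  u = fresh U c y
  q = all (fresh U c) σ
  a = not (anyAbove y σ)
  g = not (has12Above t σ)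

-- Counting 123-avoiding permutations

band : (ℕ → Bool) → ℕ → ℕ → ℕ → Bool
band U t c z = not (U z) ∧ (t <ᵇ z) ∧ (z <ᵇ c)

module _ (U : ℕ → Bool) where

  fresh-new-minimum : ∀ y t z → y < t → fresh (extend U y) y z ≡ fresh U t z ∧ (z <ᵇ y)
  fresh-new-minimum y t z y<t with <-cmp z y
  ... | tri< z<y _ _ rewrite ≡ᵇ-false {y} {z} (λ e → <-irrefl (sym e) z<y) | <ᵇ-true z<y | <ᵇ-true (<-trans z<y y<t) with U z
  ...   | true  = refl
  ...   | false = refl
  fresh-new-minimum y t z y<t | tri≈ _ refl _ rewrite <ᵇ-irrefl z = trans (∧-zeroʳ _) (sym (∧-zeroʳ _))
  fresh-new-minimum y t z y<t | tri> _ _ y<z rewrite <ᵇ-false {z} {y} (<⇒≤ y<z) = trans (∧-zeroʳ _) (sym (∧-zeroʳ _))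

  fresh-split-at : ∀ y t z → U y ≡ false → y < t →
    indicator (fresh U t z) ≡ indicator (fresh U t z ∧ (z <ᵇ y)) + (indicator (y ≡ᵇ z) + indicator (fresh U t z ∧ (y <ᵇ z)))
  fresh-split-at y t z Uy y<t with <-cmp z y
  ... | tri< z<y _ _ rewrite ≡ᵇ-false {y} {z} (λ e → <-irrefl (sym e) z<y) | <ᵇ-true z<y | <ᵇ-true (<-trans z<y y<t)
                           | <ᵇ-false {y} {z} (<⇒≤ z<y) with U z
  ...   | true  = refl
  ...   | false = refl
  fresh-split-at y t z Uy y<t | tri≈ _ refl _ rewrite Uy | ≡ᵇ-refl y | <ᵇ-true y<t | <ᵇ-irrefl y = refl
  fresh-split-at y t z Uy y<t | tri> _ _ y<z rewrite <ᵇ-false {z} {y} (<⇒≤ y<z) | ≡ᵇ-false {y} {z} (λ e → <-irrefl e y<z)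
                                                 | <ᵇ-true y<z with U z | z <ᵇ t
  ...   | true  | _     = refl
  ...   | false | true  = refl
  ...   | false | false = refl

  band-new-minimum : ∀ m y t c z → y < t → t ≤ c → (U t ≡ true ⊎ m < t) → z ≤ m →
    indicator (band (extend U y) y c z) ≡ indicator (fresh U t z ∧ (y <ᵇ z)) + indicator (band U t c z)
  band-new-minimum m y t c z y<t t≤c anchored z≤m with <-cmp z t
  ... | tri< z<t _ _ rewrite <ᵇ-true z<t | <ᵇ-false {t} {z} (<⇒≤ z<t) | <ᵇ-true (<-≤-trans z<t t≤c) with <-cmp y z
  ...   | tri< y<z _ _ rewrite <ᵇ-true y<z | ≡ᵇ-false {y} {z} (λ e → <-irrefl e y<z) with U z
  ...     | true  = refl
  ...     | false = refl
  band-new-minimum m y t c z y<t t≤c anchored z≤m | tri< z<t _ _ | tri≈ _ refl _ rewrite <ᵇ-irrefl y | ≡ᵇ-refl y with U y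
  ...     | true  = refl
  ...     | false = refl
  band-new-minimum m y t c z y<t t≤c anchored z≤m | tri< z<t _ _ | tri> _ _ z<y
    rewrite <ᵇ-false {y} {z} (<⇒≤ z<y) | ≡ᵇ-false {y} {z} (λ e → <-irrefl (sym e) z<y) with U z
  ...     | true  = refl
  ...     | false = refl
  band-new-minimum m y t c z y<t t≤c (inj₁ Ut) z≤m | tri≈ _ refl _ rewrite Ut = refl
  band-new-minimum m y t c z y<t t≤c (inj₂ m<t) z≤m | tri≈ _ refl _ = ⊥-elim (<-irrefl refl (≤-<-trans z≤m m<t))
  band-new-minimum m y t c z y<t t≤c anchored z≤m | tri> _ _ t<z
    rewrite <ᵇ-false {z} {t} (<⇒≤ t<z) | <ᵇ-true t<z | <ᵇ-true (<-trans y<t t<z) | ≡ᵇ-false {y} {z} (λ e → <-irrefl e (<-trans y<t t<z))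
    with U z | z <ᵇ c
  ...   | true  | _     = refl
  ...   | false | true  = refl
  ...   | false | false = refl

  fresh-above-minimum : ∀ y t z → t < y → fresh (extend U y) t z ≡ fresh U t z
  fresh-above-minimum y t z t<y with <-cmp z t
  ... | tri< z<t _ _ rewrite <ᵇ-true z<t | ≡ᵇ-false {y} {z} (λ e → <-irrefl (sym e) (<-trans z<t t<y)) with U z
  ...   | true  = refl
  ...   | false = refl
  fresh-above-minimum y t z t<y | tri≈ _ refl _ rewrite <ᵇ-irrefl z = trans (∧-zeroʳ _) (sym (∧-zeroʳ _))
  fresh-above-minimum y t z t<y | tri> _ _ t<z rewrite <ᵇ-false {z} {t} (<⇒≤ t<z) = trans (∧-zeroʳ _) (sym (∧-zeroʳ _))

  band-lowered-cap : ∀ y t c z → y < c → band (extend U y) t y z ≡ band U t c z ∧ (z <ᵇ y)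
  band-lowered-cap y t c z y<c with <-cmp z y
  ... | tri< z<y _ _ rewrite <ᵇ-true z<y | <ᵇ-true (<-trans z<y y<c) | ≡ᵇ-false {y} {z} (λ e → <-irrefl (sym e) z<y) with U z | t <ᵇ z
  ...   | true  | _     = refl
  ...   | false | true  = refl
  ...   | false | false = refl
  band-lowered-cap y t c z y<c | tri≈ _ refl _ rewrite <ᵇ-irrefl z | ≡ᵇ-refl z with U z
  ...   | true  = refl
  ...   | false = sym (∧-zeroʳ _)
  band-lowered-cap y t c z y<c | tri> _ _ y<z rewrite <ᵇ-false {z} {y} (<⇒≤ y<z) | ≡ᵇ-false {y} {z} (λ e → <-irrefl e y<z) with U z | t <ᵇ z
  ...   | true  | _     = refl
  ...   | false | true  = sym (∧-zeroʳ _)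
  ...   | false | false = refl

module Completions (N : ℕ) where

  completions : (ℕ → Bool) → ℕ → ℕ → ℕ → ℕ
  completions U t c n = count (admissible U t c) (words N n)

  lowCount : (ℕ → Bool) → ℕ → ℕ
  lowCount U t = countValues N (fresh U t)

  bandCount : (ℕ → Bool) → ℕ → ℕ → ℕ
  bandCount U t c = countValues N (band U t c)

  -- the minimum is a used value, or exceeds every value while nothing has been written
  Anchored : (ℕ → Bool) → ℕ → Set
  Anchored U t = U t ≡ true ⊎ N < t

  anchored-extend : ∀ {U t} y → Anchored U t → Anchored (extend U y) t
  anchored-extend y (inj₁ Ut)  = inj₁ (cong (_∨ _) Ut)
  anchored-extend y (inj₂ N<t) = inj₂ N<t

  anchored-new : ∀ U y → Anchored (extend U y) y
  anchored-new U y = inj₁ (∨-introʳ (U y) (≡ᵇ-refl y))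

  rank : (ℕ → Bool) → ℕ → ℕ → ℕ
  rank U t y = countValues (pred y) (fresh U t)

  lowCount-new-minimum : ∀ U y t → 1 ≤ y → y ≤ N → y < t → lowCount (extend U y) y ≡ rank U t y
  lowCount-new-minimum U y t 1≤y y≤N y<t =
    trans (countValues-cong N _ _ (λ z _ _ → fresh-new-minimum U y t z y<t))
          (countValues-below N (fresh U t) y 1≤y (≤-trans pred[n]≤n y≤N))

  bandCount-new-minimum : ∀ U y t c → 1 ≤ y → y ≤ N → y < t → t ≤ c → Anchored U t → U y ≡ false →
    bandCount (extend U y) y c ≡ bandCount U t c + (lowCount U t ∸ suc (rank U t y))
  bandCount-new-minimum U y t c 1≤y y≤N y<t t≤c anchored Uy = begin
    bandCount (extend U y) y c     ≡⟨ countValues-split N _ _ _ (λ z _ z≤N → band-new-minimum U N y t c z y<t t≤c anchored z≤N) ⟩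
    above + bandCount U t c        ≡⟨ +-comm above _ ⟩
    bandCount U t c + above        ≡⟨ cong (bandCount U t c +_) (sym lowCount-above) ⟩
    bandCount U t c + (lowCount U t ∸ suc (rank U t y)) ∎
    where
    open ≡-Reasoning
    above : ℕ
    above = countValues N (λ z → fresh U t z ∧ (y <ᵇ z))
    lowCount-split : lowCount U t ≡ rank U t y + (1 + above)
    lowCount-split = begin
      lowCount U t
        ≡⟨ sumValues-cong N (λ z _ _ → fresh-split-at U y t z Uy y<t) ⟩
      sumValues N (λ z → indicator (fresh U t z ∧ (z <ᵇ y)) + (indicator (y ≡ᵇ z) + indicator (fresh U t z ∧ (y <ᵇ z))))
        ≡⟨ sumValues-+ N _ _ ⟩
      countValues N (λ z → fresh U t z ∧ (z <ᵇ y)) + sumValues N (λ z → indicator (y ≡ᵇ z) + indicator (fresh U t z ∧ (y <ᵇ z)))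
        ≡⟨ cong₂ _+_ (countValues-below N (fresh U t) y 1≤y (≤-trans pred[n]≤n y≤N))
                     (trans (sumValues-+ N _ _) (cong (_+ above) (countValues-single N y 1≤y y≤N))) ⟩
      rank U t y + (1 + above) ∎
    lowCount-above : lowCount U t ∸ suc (rank U t y) ≡ above
    lowCount-above = trans (cong (_∸ suc (rank U t y)) (trans lowCount-split (+-suc (rank U t y) above)))
                           (m+n∸m≡n (suc (rank U t y)) above)

  lowCount-above-minimum : ∀ U y t → t < y → lowCount (extend U y) t ≡ lowCount U t
  lowCount-above-minimum U y t t<y = countValues-cong N _ _ (λ z _ _ → fresh-above-minimum U y t z t<y)

  bandCount-lowered-cap : ∀ U y t c → 1 ≤ y → y ≤ N → y < c → bandCount (extend U y) t y ≡ countValues (pred y) (band U t c)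
  bandCount-lowered-cap U y t c 1≤y y≤N y<c =
    trans (countValues-cong N _ _ (λ z _ _ → band-lowered-cap U y t c z y<c))
          (countValues-below N (band U t c) y 1≤y (≤-trans pred[n]≤n y≤N))

  FillHypothesis : ℕ → Set
  FillHypothesis n = ∀ U t c → Anchored U t → t ≤ c → completions U t c n ≡ fill n (lowCount U t) (bandCount U t c)

  lowTerm : ℕ → (ℕ → Bool) → ℕ → ℕ → ℕ → ℕ
  lowTerm n U t c y = if fresh U t y then fill n (rank U t y) (bandCount U t c + (lowCount U t ∸ suc (rank U t y))) else 0

  bandTerm : ℕ → (ℕ → Bool) → ℕ → ℕ → ℕ → ℕ
  bandTerm n U t c y = if band U t c y then fill n (lowCount U t) (countValues (pred y) (band U t c)) else 0

  completions-first : ∀ {n} → FillHypothesis n → ∀ U t c → Anchored U t → t ≤ c → ∀ y → 1 ≤ y → y ≤ N →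
    count (λ σ → admissible U t c (y ∷ σ)) (words N n) ≡ lowTerm n U t c y + bandTerm n U t c y
  completions-first {n} hyp U t c anchored t≤c y 1≤y y≤N with <-cmp y t
  ... | tri< y<t _ _ =
    trans (count-cong (words N n) (λ σ → admissible-∷-low U t c y σ y<t))
          (trans (count-guard (fresh U c y) (admissible (extend U y) y c) (words N n)) (by-use (U y) refl))
    where
    by-use : ∀ u → U y ≡ u → (if not u ∧ (y <ᵇ c) then completions (extend U y) y c n else 0) ≡ lowTerm n U t c y + bandTerm n U t c y
    by-use true  Uy rewrite Uy = refl
    by-use false Uy rewrite Uy | <ᵇ-true (<-≤-trans y<t t≤c) | <ᵇ-true y<t | <ᵇ-false {t} {y} (<⇒≤ y<t) =
      trans (hyp (extend U y) y c (anchored-new U y) (<⇒≤ (<-≤-trans y<t t≤c)))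
            (trans (cong₂ (fill n) (lowCount-new-minimum U y t 1≤y y≤N y<t)
                                   (bandCount-new-minimum U y t c 1≤y y≤N y<t t≤c anchored Uy))
                   (sym (+-identityʳ _)))
  ... | tri≈ _ refl _ = minimum anchored
    where
    minimum : Anchored U t → count (λ σ → admissible U t c (t ∷ σ)) (words N n) ≡ lowTerm n U t c t + bandTerm n U t c t
    minimum (inj₂ N<t) = ⊥-elim (<-irrefl refl (≤-<-trans y≤N N<t))
    minimum (inj₁ Ut) =
      trans (count-cong (words N n) (λ σ → admissible-∷-stale U t c t σ (cong (λ u → not u ∧ (t <ᵇ c)) Ut)))
            (trans (count-false (words N n)) (sym unused))
      where
      unused : lowTerm n U t c t + bandTerm n U t c t ≡ 0
      unused rewrite Ut = refl
  ... | tri> _ _ t<y with y <? c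
  ...   | yes y<c =
    trans (count-cong (words N n) (λ σ → admissible-∷-band U t c y σ t<y y<c))
          (trans (count-guard (fresh U c y) (admissible (extend U y) t y) (words N n)) (by-use (U y) refl))
    where
    by-use : ∀ u → U y ≡ u → (if not u ∧ (y <ᵇ c) then completions (extend U y) t y n else 0) ≡ lowTerm n U t c y + bandTerm n U t c y
    by-use true  Uy rewrite Uy = refl
    by-use false Uy rewrite Uy | <ᵇ-true y<c | <ᵇ-false {y} {t} (<⇒≤ t<y) | <ᵇ-true t<y =
      trans (hyp (extend U y) t y (anchored-extend {U} y anchored) (<⇒≤ t<y))
            (cong₂ (fill n) (lowCount-above-minimum U y t t<y) (bandCount-lowered-cap U y t c 1≤y y≤N y<c))
  ...   | no y≮c =
    trans (count-cong (words N n) (λ σ → admissible-∷-stale U t c y σ capped)) (trans (count-false (words N n)) (sym outside))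
    where
    capped : fresh U c y ≡ false
    capped rewrite <ᵇ-false {y} {c} (≮⇒≥ y≮c) = ∧-zeroʳ (not (U y))
    outside : lowTerm n U t c y + bandTerm n U t c y ≡ 0
    outside with U y
    ... | true  = refl
    ... | false rewrite <ᵇ-false {y} {t} (<⇒≤ t<y) | <ᵇ-false {y} {c} (≮⇒≥ y≮c) | <ᵇ-true t<y = refl

  completions≡fill : ∀ n → FillHypothesis n
  completions≡fill zero    U t c anchored t≤c = refl
  completions≡fill (suc n) U t c anchored t≤c = begin
    completions U t c (suc n)                                              ≡⟨ count-words-suc N n (admissible U t c) ⟩
    sumValues N (λ y → count (λ σ → admissible U t c (y ∷ σ)) (words N n))
      ≡⟨ sumValues-cong N (completions-first {n} (completions≡fill n) U t c anchored t≤c) ⟩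
    sumValues N (λ y → lowTerm n U t c y + bandTerm n U t c y)              ≡⟨ sumValues-+ N (lowTerm n U t c) (bandTerm n U t c) ⟩
    sumValues N (lowTerm n U t c) + sumValues N (bandTerm n U t c)
      ≡⟨ cong₂ _+_ (sumValues-rank N (fresh U t) (λ i → fill n i (bandCount U t c + (lowCount U t ∸ suc i))))
                   (sumValues-rank N (band U t c) (fill n (lowCount U t))) ⟩
    fill (suc n) (lowCount U t) (bandCount U t c)                          ∎
    where open ≡-Reasoning

all-at : ∀ (p : ℕ → Bool) σ k x → all p σ ≡ true → at σ k ≡ x → 1 ≤ x → p x ≡ true
all-at p []      k             x _   refl ()
all-at p (y ∷ σ) zero          x _   refl ()
all-at p (y ∷ σ) (suc zero)    x allp refl _   = ∧-elimˡ allp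
all-at p (y ∷ σ) (suc (suc k)) x allp at≡x 1≤x = all-at p σ (suc k) x (∧-elimʳ {p y} allp) at≡x 1≤x

module TopCompletions (M : ℕ) where

  N : ℕ
  N = suc M
  open Completions N

  topCompletions : (ℕ → Bool) → ℕ → ℕ → ℕ → ℕ → ℕ
  topCompletions U t c n j = count (λ σ → admissible U t c σ ∧ (at σ (suc j) ≡ᵇ N)) (words N n)

  topCompletions-unavailable : ∀ n j U t c → fresh U c N ≡ false → topCompletions U t c n j ≡ 0
  topCompletions-unavailable n j U t c stale = trans (count-cong (words N n) never) (count-false (words N n))
    where
    never : ∀ σ → (admissible U t c σ ∧ (at σ (suc j) ≡ᵇ N)) ≡ false
    never σ with admissible U t c σ in adm | at σ (suc j) ≡ᵇ N in top
    ... | false | _     = refl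
    ... | true  | false = refl
    ... | true  | true  = ⊥-elim (false≢true (trans (sym stale)
          (all-at (fresh U c) σ (suc j) N (∧-elimˡ (∧-elimʳ {isAv123 σ} adm)) (≡ᵇ-sound top) (s≤s z≤n))))

  freshBelowTop : (ℕ → Bool) → ℕ → ℕ → Bool
  freshBelowTop U t y = fresh U t y ∧ not (y ≡ᵇ N)

  countValues-freshBelowTop : ∀ U t m → m ≤ M → countValues m (freshBelowTop U t) ≡ countValues m (fresh U t)
  countValues-freshBelowTop U t m m≤M = countValues-cong m _ _ (λ z _ z≤m →
    trans (cong (λ u → fresh U t z ∧ not u) (≡ᵇ-false {z} {N} (λ e → <-irrefl e (s≤s (≤-trans z≤m m≤M))))) (∧-identityʳ _))

  countValues-freshBelowTop-all : ∀ U t → countValues N (freshBelowTop U t) ≡ countValues M (fresh U t)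
  countValues-freshBelowTop-all U t =
    trans (cong₂ _+_ (countValues-freshBelowTop U t M ≤-refl)
                     (cong indicator (trans (cong (λ u → fresh U t N ∧ not u) (≡ᵇ-refl N)) (∧-zeroʳ _))))
          (+-identityʳ _)

  bandCount-empty : ∀ U t c → N < t → bandCount U t c ≡ 0
  bandCount-empty U t c N<t = countValues-none N _ (λ z _ z≤N →
    trans (cong (λ u → not (U z) ∧ u ∧ (z <ᵇ c)) (<ᵇ-false {t} {z} (≤-trans z≤N (<⇒≤ N<t)))) (∧-zeroʳ (not (U z))))

  lowCount-with-top : ∀ U t → N < t → U N ≡ false → lowCount U t ≡ suc (countValues M (fresh U t))
  lowCount-with-top U t N<t UN =
    trans (cong (λ u → countValues M (fresh U t) + indicator u) (cong₂ (λ u v → not u ∧ v) UN (<ᵇ-true N<t))) (+-comm _ 1)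

  lowCount-without-top : ∀ U t → t < N → lowCount U t ≡ countValues M (fresh U t)
  lowCount-without-top U t t<N =
    trans (cong (λ u → countValues M (fresh U t) + indicator u) (trans (cong (not (U N) ∧_) (<ᵇ-false {N} {t} (<⇒≤ t<N))) (∧-zeroʳ _)))
          (+-identityʳ _)

  bandCount-with-top : ∀ U t → t < N → U N ≡ false → bandCount U t (suc N) ≡ suc (countValues M (band U t (suc N)))
  bandCount-with-top U t t<N UN =
    trans (cong (λ u → countValues M (band U t (suc N)) + indicator u)
                (cong₂ (λ u v → not u ∧ v) UN (trans (cong (_∧ (N <ᵇ suc N)) (<ᵇ-true t<N)) (<ᵇ-true {N} {suc N} ≤-refl))))
          (+-comm _ 1)

  private
    anchored-top : ∀ {U t} → Anchored U t → U N ≡ false → N ≢ t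
    anchored-top (inj₁ Ut)  UN refl = false≢true (trans (sym UN) Ut)
    anchored-top (inj₂ N<t) UN refl = <-irrefl refl N<t

    topFirst : ∀ n U t → Anchored U t → t ≤ suc N → U N ≡ false →
      count (λ σ → admissible U t (suc N) (N ∷ σ)) (words N n) ≡ fillTop (suc n) (lowCount U t) (bandCount U t (suc N)) 0
    topFirst n U t anchored t≤c UN with <-cmp N t
    ... | tri< N<t _ _ = begin
      count (λ σ → admissible U t (suc N) (N ∷ σ)) (words N n)
        ≡⟨ count-cong (words N n) (λ σ → admissible-∷-low U t (suc N) N σ N<t) ⟩
      count (λ σ → fresh U (suc N) N ∧ admissible (extend U N) N (suc N) σ) (words N n)
        ≡⟨ count-guard (fresh U (suc N) N) (admissible (extend U N) N (suc N)) (words N n) ⟩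
      (if fresh U (suc N) N then completions (extend U N) N (suc N) n else 0)
        ≡⟨ if-true (fresh U (suc N) N) (cong₂ (λ u v → not u ∧ v) UN (<ᵇ-true {N} {suc N} ≤-refl)) ⟩
      completions (extend U N) N (suc N) n
        ≡⟨ completions≡fill n (extend U N) N (suc N) (anchored-new U N) (n≤1+n N) ⟩
      fill n (lowCount (extend U N) N) (bandCount (extend U N) N (suc N))
        ≡⟨ cong₂ (fill n) (lowCount-new-minimum U N t (s≤s z≤n) ≤-refl N<t)
                          (bandCount-new-minimum U N t (suc N) (s≤s z≤n) ≤-refl N<t t≤c anchored UN) ⟩
      fill n r (bandCount U t (suc N) + (lowCount U t ∸ suc r))
        ≡⟨ cong (fill n r) (cong₂ _+_ (bandCount-empty U t (suc N) N<t)
                                      (trans (cong (_∸ suc r) (lowCount-with-top U t N<t UN)) (n∸n≡0 (suc r)))) ⟩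
      fill n r 0
        ≡⟨ sym (cong₂ (λ a b → fillTop (suc n) a b 0) (lowCount-with-top U t N<t UN) (bandCount-empty U t (suc N) N<t)) ⟩
      fillTop (suc n) (lowCount U t) (bandCount U t (suc N)) 0 ∎
      where
      open ≡-Reasoning
      r : ℕ
      r = countValues M (fresh U t)
    ... | tri≈ _ N≡t _ = ⊥-elim (anchored-top {U} anchored UN N≡t)
    ... | tri> _ _ t<N = begin
      count (λ σ → admissible U t (suc N) (N ∷ σ)) (words N n)
        ≡⟨ count-cong (words N n) (λ σ → admissible-∷-band U t (suc N) N σ t<N ≤-refl) ⟩
      count (λ σ → fresh U (suc N) N ∧ admissible (extend U N) t N σ) (words N n)
        ≡⟨ count-guard (fresh U (suc N) N) (admissible (extend U N) t N) (words N n) ⟩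
      (if fresh U (suc N) N then completions (extend U N) t N n else 0)
        ≡⟨ if-true (fresh U (suc N) N) (cong₂ (λ u v → not u ∧ v) UN (<ᵇ-true {N} {suc N} ≤-refl)) ⟩
      completions (extend U N) t N n
        ≡⟨ completions≡fill n (extend U N) t N (anchored-extend {U} N anchored) (<⇒≤ t<N) ⟩
      fill n (lowCount (extend U N) t) (bandCount (extend U N) t N)
        ≡⟨ cong₂ (fill n) (trans (lowCount-above-minimum U N t t<N) (lowCount-without-top U t t<N))
                          (bandCount-lowered-cap U N t (suc N) (s≤s z≤n) ≤-refl ≤-refl) ⟩
      fill n (countValues M (fresh U t)) (countValues M (band U t (suc N)))
        ≡⟨ sym (cong₂ (λ a b → fillTop (suc n) a b 0) (lowCount-without-top U t t<N) (bandCount-with-top U t t<N UN)) ⟩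
      fillTop (suc n) (lowCount U t) (bandCount U t (suc N)) 0 ∎
      where open ≡-Reasoning

  TopHypothesis : ℕ → ℕ → Set
  TopHypothesis n j = ∀ U t → Anchored U t → t ≤ suc N → U N ≡ false →
    topCompletions U t (suc N) n j ≡ fillTop n (lowCount U t) (bandCount U t (suc N)) j

  topLaterFill : ℕ → ℕ → (ℕ → Bool) → ℕ → ℕ → ℕ
  topLaterFill n j U t i = fillTop n i (bandCount U t (suc N) + (lowCount U t ∸ suc i)) j

  topLaterTerm : ℕ → ℕ → (ℕ → Bool) → ℕ → ℕ → ℕ
  topLaterTerm n j U t y = if freshBelowTop U t y then topLaterFill n j U t (countValues (pred y) (freshBelowTop U t)) else 0

  topCompletions-later-first : ∀ {n j} → TopHypothesis n j → ∀ U t → Anchored U t → t ≤ suc N → U N ≡ false →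
    ∀ y → 1 ≤ y → y ≤ N → count (λ σ → admissible U t (suc N) (y ∷ σ) ∧ (at σ (suc j) ≡ᵇ N)) (words N n) ≡ topLaterTerm n j U t y
  topCompletions-later-first {n} {j} hyp U t anchored t≤c UN y 1≤y y≤N with <-cmp y t
  ... | tri< y<t _ _ =
    trans (count-cong (words N n) (λ σ → trans (cong (_∧ top σ) (admissible-∷-low U t (suc N) y σ y<t))
                                               (∧-assoc (fresh U (suc N) y) _ (top σ))))
          (trans (count-guard (fresh U (suc N) y) (λ σ → admissible (extend U y) y (suc N) σ ∧ top σ) (words N n)) (by-use (U y) refl))
    where
    top : List ℕ → Bool
    top σ = at σ (suc j) ≡ᵇ N
    by-use : ∀ u → U y ≡ u → (if not u ∧ (y <ᵇ suc N) then topCompletions (extend U y) y (suc N) n j else 0) ≡ topLaterTerm n j U t y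
    by-use true Uy rewrite Uy = refl
    by-use false Uy with y ≟ N
    ... | yes refl =
      trans (if-true (N <ᵇ suc N) (<ᵇ-true {N} {suc N} ≤-refl))
        (trans (topCompletions-unavailable n j (extend U N) N (suc N) (cong (λ u → not u ∧ (N <ᵇ suc N)) (∨-introʳ (U N) (≡ᵇ-refl N))))
               (sym (if-false (freshBelowTop U t N) (trans (cong (fresh U t N ∧_) (cong not (≡ᵇ-refl N))) (∧-zeroʳ _)))))
    ... | no y≢N =
      trans (if-true _ (<ᵇ-true {y} {suc N} (s≤s y≤N)))
        (trans (hyp (extend U y) y (anchored-new U y) (m≤n⇒m≤1+n y≤N) (cong₂ _∨_ UN (≡ᵇ-false y≢N)))
        (trans (cong₂ (λ a b → fillTop n a b j) (lowCount-new-minimum U y t 1≤y y≤N y<t)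
                                                (bandCount-new-minimum U y t (suc N) 1≤y y≤N y<t t≤c anchored Uy))
        (trans (cong (topLaterFill n j U t) (sym (countValues-freshBelowTop U t (pred y) (pred-mono-≤ y≤N))))
               (sym (if-true (freshBelowTop U t y)
                      (trans (cong₂ (λ u v → (not u ∧ v) ∧ not (y ≡ᵇ N)) Uy (<ᵇ-true y<t)) (cong not (≡ᵇ-false y≢N))))))))
  ... | tri≈ _ refl _ = minimum anchored
    where
    top : List ℕ → Bool
    top σ = at σ (suc j) ≡ᵇ N
    minimum : Anchored U t → count (λ σ → admissible U t (suc N) (t ∷ σ) ∧ top σ) (words N n) ≡ topLaterTerm n j U t t
    minimum (inj₂ N<t) = ⊥-elim (<-irrefl refl (≤-<-trans y≤N N<t))
    minimum (inj₁ Ut)  =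
      trans (count-cong (words N n) (λ σ → cong (_∧ top σ) (admissible-∷-stale U t (suc N) t σ (cong (λ u → not u ∧ (t <ᵇ suc N)) Ut))))
            (trans (count-false (words N n)) (sym (if-false (freshBelowTop U t t) (cong (λ u → (not u ∧ (t <ᵇ t)) ∧ not (t ≡ᵇ N)) Ut))))
  ... | tri> _ _ t<y =
    trans (count-cong (words N n) (λ σ → trans (cong (_∧ top σ) (admissible-∷-band U t (suc N) y σ t<y (s≤s y≤N)))
                                               (∧-assoc (fresh U (suc N) y) _ (top σ))))
    (trans (count-guard (fresh U (suc N) y) (λ σ → admissible (extend U y) t y σ ∧ top σ) (words N n))
    (trans (capped (fresh U (suc N) y))
           (sym (if-false (freshBelowTop U t y) (trans (cong (λ v → (not (U y) ∧ v) ∧ not (y ≡ᵇ N)) (<ᵇ-false {y} {t} (<⇒≤ t<y)))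
                                                       (cong (_∧ not (y ≡ᵇ N)) (∧-zeroʳ (not (U y)))))))))
    where
    top : List ℕ → Bool
    top σ = at σ (suc j) ≡ᵇ N
    capped : ∀ b → (if b then topCompletions (extend U y) t y n j else 0) ≡ 0
    capped true  = topCompletions-unavailable n j (extend U y) t y (trans (cong (not (extend U y N) ∧_) (<ᵇ-false {N} {y} y≤N)) (∧-zeroʳ _))
    capped false = refl

  sumBelow-topLaterFill : ∀ n j U t → Anchored U t → U N ≡ false →
    sumBelow (countValues M (fresh U t)) (topLaterFill n j U t) ≡ fillTop (suc n) (lowCount U t) (bandCount U t (suc N)) (suc j)
  sumBelow-topLaterFill n j U t anchored UN with <-cmp N t
  ... | tri< N<t _ _ =
    trans (sumBelow-cong (countValues M (fresh U t)) (λ i _ → cong (λ b → fillTop n i b j)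
                                      (cong₂ (λ a b → b + (a ∸ suc i)) (lowCount-with-top U t N<t UN) (bandCount-empty U t (suc N) N<t))))
          (sym (cong₂ (λ a b → fillTop (suc n) a b (suc j)) (lowCount-with-top U t N<t UN) (bandCount-empty U t (suc N) N<t)))
  ... | tri≈ _ N≡t _ = ⊥-elim (anchored-top {U} anchored UN N≡t)
  ... | tri> _ _ t<N =
    trans (cong (λ m → sumBelow m (topLaterFill n j U t)) (sym (lowCount-without-top U t t<N)))
    (trans (sumBelow-cong (lowCount U t) (λ i _ → cong (λ b → fillTop n i (b + (lowCount U t ∸ suc i)) j) (bandCount-with-top U t t<N UN)))
           (sym (cong (λ b → fillTop (suc n) (lowCount U t) b (suc j)) (bandCount-with-top U t t<N UN))))

  topCompletions≡fillTop : ∀ n j → TopHypothesis n j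
  topCompletions≡fillTop zero j U t anchored t≤c UN = refl
  topCompletions≡fillTop (suc n) zero U t anchored t≤c UN = begin
    topCompletions U t (suc N) (suc n) 0                          ≡⟨ count-words-suc N n _ ⟩
    sumValues M G + G N                                           ≡⟨ cong₂ _+_ (sumValues-cong M notTop) isTop ⟩
    sumValues M (λ _ → 0) + count (λ σ → admissible U t (suc N) (N ∷ σ)) (words N n)
                                                                  ≡⟨ cong (_+ count (λ σ → admissible U t (suc N) (N ∷ σ)) (words N n)) (sumValues-zero M) ⟩
    count (λ σ → admissible U t (suc N) (N ∷ σ)) (words N n)      ≡⟨ topFirst n U t anchored t≤c UN ⟩
    fillTop (suc n) (lowCount U t) (bandCount U t (suc N)) 0      ∎
    where
    open ≡-Reasoning
    G : ℕ → ℕ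
    G y = count (λ σ → admissible U t (suc N) (y ∷ σ) ∧ (y ≡ᵇ N)) (words N n)
    notTop : ∀ y → 1 ≤ y → y ≤ M → G y ≡ 0
    notTop y _ y≤M = trans (count-cong (words N n) (λ σ → trans (cong (admissible U t (suc N) (y ∷ σ) ∧_) (≡ᵇ-false (λ e → <-irrefl e (s≤s y≤M))))
                                                              (∧-zeroʳ _)))
                           (count-false (words N n))
    isTop : G N ≡ count (λ σ → admissible U t (suc N) (N ∷ σ)) (words N n)
    isTop = count-cong (words N n) (λ σ → trans (cong (admissible U t (suc N) (N ∷ σ) ∧_) (≡ᵇ-refl N)) (∧-identityʳ _))
  topCompletions≡fillTop (suc n) (suc j) U t anchored t≤c UN = begin
    topCompletions U t (suc N) (suc n) (suc j)
      ≡⟨ count-words-suc N n _ ⟩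
    sumValues N (λ y → count (λ σ → admissible U t (suc N) (y ∷ σ) ∧ (at σ (suc j) ≡ᵇ N)) (words N n))
      ≡⟨ sumValues-cong N (topCompletions-later-first {n} {j} (topCompletions≡fillTop n j) U t anchored t≤c UN) ⟩
    sumValues N (topLaterTerm n j U t)
      ≡⟨ sumValues-rank N (freshBelowTop U t) (topLaterFill n j U t) ⟩
    sumBelow (countValues N (freshBelowTop U t)) (topLaterFill n j U t)
      ≡⟨ cong (λ m → sumBelow m (topLaterFill n j U t)) (countValues-freshBelowTop-all U t) ⟩
    sumBelow (countValues M (fresh U t)) (topLaterFill n j U t)
      ≡⟨ sumBelow-topLaterFill n j U t anchored UN ⟩
    fillTop (suc n) (lowCount U t) (bandCount U t (suc N)) (suc j) ∎
    where open ≡-Reasoning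

inRange : ℕ → ℕ → Bool
inRange N x = (0 <ᵇ x) ∧ (x <ᵇ suc N)

count-words-cong : ∀ N n (p q : List ℕ → Bool) → (∀ σ → length σ ≡ n → all (inRange N) σ ≡ true → p σ ≡ q σ) →
  count p (words N n) ≡ count q (words N n)
count-words-cong N zero    p q p≗q =
  trans (count-∷ p [] []) (trans (cong (λ b → indicator b + 0) (p≗q [] refl refl)) (sym (count-∷ q [] [])))
count-words-cong N (suc n) p q p≗q = trans (count-words-suc N n p) (trans (sumValues-cong N (λ y 1≤y y≤N →
  count-words-cong N n _ _ (λ σ len inσ → p≗q (y ∷ σ) (cong suc len) (cong₂ _∧_ (cong₂ _∧_ (<ᵇ-true 1≤y) (<ᵇ-true (s≤s y≤N))) inσ))))
  (sym (count-words-suc N n q)))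

count-Av123 : ∀ N (q : List ℕ → Bool) → count q (Av123 N) ≡ count (λ π → isAv123 π ∧ q π) (words N N)
count-Av123 N q = trans (count-filterᵇ _ q (words N N)) (count-cong (words N N) (λ π → cong (_∧ q π) (distinct∧avoids≡isAv123 π)))

count-Av123-cong : ∀ N (q q′ : List ℕ → Bool) →
  (∀ π → length π ≡ N → all (inRange N) π ≡ true → isAv123 π ≡ true → q π ≡ q′ π) → count q (Av123 N) ≡ count q′ (Av123 N)
count-Av123-cong N q q′ q≗q′ = trans (count-Av123 N q) (trans (count-words-cong N N _ _ pointwise) (sym (count-Av123 N q′)))
  where
  pointwise : ∀ σ → length σ ≡ N → all (inRange N) σ ≡ true → (isAv123 σ ∧ q σ) ≡ (isAv123 σ ∧ q′ σ)
  pointwise σ len inσ with isAv123 σ in av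
  ... | true  = q≗q′ σ len inσ av
  ... | false = refl

has12Above-top : ∀ t σ → all (λ z → z <ᵇ suc t) σ ≡ true → has12Above t σ ≡ false
has12Above-top t []      _   = refl
has12Above-top t (z ∷ σ) below rewrite <ᵇ-false {t} {z} (≤-pred (<ᵇ-sound (∧-elimˡ below))) = has12Above-top t σ (∧-elimʳ {z <ᵇ suc t} below)

-- before anything is written, every value is free and the minimum and cap lie above all of them
isAv123≡admissible-initial : ∀ N σ → all (inRange N) σ ≡ true → isAv123 σ ≡ admissible (λ _ → false) (suc N) (suc N) σ
isAv123≡admissible-initial N σ inσ
  rewrite all-mono σ (λ z z∈ → ∧-elimʳ {0 <ᵇ z} z∈) inσ
        | has12Above-top (suc N) σ (all-mono σ (λ z z∈ → <ᵇ-true {z} (m≤n⇒m≤1+n (<ᵇ-sound {z} (∧-elimʳ {0 <ᵇ z} z∈)))) inσ) =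
  sym (∧-identityʳ _)

module CountingAv123 (M : ℕ) where

  N : ℕ
  N = suc M
  open Completions N
  open TopCompletions M using (topCompletions; topCompletions≡fillTop)

  private
    lowCount-initial : lowCount (λ _ → false) (suc N) ≡ N
    lowCount-initial = countValues-all N _ (λ z _ z≤N → <ᵇ-true (s≤s z≤N))

    bandCount-initial : bandCount (λ _ → false) (suc N) (suc N) ≡ 0
    bandCount-initial = countValues-none N _ (λ z _ z≤N → cong (_∧ (z <ᵇ suc N)) (<ᵇ-false {suc N} {z} (m≤n⇒m≤1+n z≤N)))

  length-Av123 : length (Av123 N) ≡ catalan N
  length-Av123 = begin
    length (Av123 N)                                                   ≡⟨ length≡count-true (Av123 N) ⟩
    count (λ _ → true) (Av123 N)                                       ≡⟨ count-Av123 N (λ _ → true) ⟩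
    count (λ π → isAv123 π ∧ true) (words N N)
      ≡⟨ count-words-cong N N _ _ (λ σ _ inσ → trans (∧-identityʳ _) (isAv123≡admissible-initial N σ inσ)) ⟩
    completions (λ _ → false) (suc N) (suc N) N                        ≡⟨ completions≡fill N (λ _ → false) (suc N) (suc N) (inj₂ ≤-refl) ≤-refl ⟩
    fill N (lowCount (λ _ → false) (suc N)) (bandCount (λ _ → false) (suc N) (suc N)) ≡⟨ cong₂ (fill N) lowCount-initial bandCount-initial ⟩
    fill N N 0                                                         ≡⟨ cong (λ m → fill m N 0) (sym (+-identityʳ N)) ⟩
    complete N 0                                                       ≡⟨ sym (catalan≡complete N) ⟩
    catalan N                                                          ∎
    where open ≡-Reasoning

  count-top-at : ∀ j → j ≤ M → count (λ π → at π (suc j) ≡ᵇ N) (Av123 N) ≡ ballot M j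
  count-top-at j j≤M = begin
    count (λ π → at π (suc j) ≡ᵇ N) (Av123 N)                          ≡⟨ count-Av123 N _ ⟩
    count (λ π → isAv123 π ∧ (at π (suc j) ≡ᵇ N)) (words N N)
      ≡⟨ count-words-cong N N _ _ (λ σ _ inσ → cong (_∧ (at σ (suc j) ≡ᵇ N)) (isAv123≡admissible-initial N σ inσ)) ⟩
    topCompletions (λ _ → false) (suc N) (suc N) N j                   ≡⟨ topCompletions≡fillTop N j (λ _ → false) (suc N) (inj₂ ≤-refl) ≤-refl refl ⟩
    fillTop N (lowCount (λ _ → false) (suc N)) (bandCount (λ _ → false) (suc N) (suc N)) j
      ≡⟨ cong₂ (λ a b → fillTop N a b j) lowCount-initial bandCount-initial ⟩
    fillTop N N 0 j                                                    ≡⟨ fillTop-from-start M j j≤M ⟩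
    complete (M ∸ j) j                                                 ≡⟨ sym (ballot≡complete-∸ M j j≤M) ⟩
    ballot M j                                                         ∎
    where open ≡-Reasoning

-- Structure of 123-avoiding permutations

at→elem : ∀ σ k x → at σ k ≡ x → 1 ≤ x → elem x σ ≡ true
at→elem []      k             x refl ()
at→elem (y ∷ σ) zero          x refl ()
at→elem (y ∷ σ) (suc zero)    x refl _   = ∨-introˡ (elem y σ) (≡ᵇ-refl y)
at→elem (y ∷ σ) (suc (suc k)) x at≡x 1≤x = ∨-introʳ (x ≡ᵇ y) (at→elem σ (suc k) x at≡x 1≤x)

elem→at : ∀ σ x → elem x σ ≡ true → ∃ λ i → 1 ≤ i × at σ i ≡ x
elem→at (y ∷ σ) x x∈ with x ≡ᵇ y in x≡y
... | true  = 1 , s≤s z≤n , sym (≡ᵇ-sound x≡y)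
... | false with elem→at σ x x∈
...   | suc i , _ , at≡x = suc (suc i) , s≤s z≤n , at≡x

isAv123-∷⁻ : ∀ x σ → isAv123 (x ∷ σ) ≡ true → (elem x σ ≡ false) × (has12Above x σ ≡ false) × (isAv123 σ ≡ true)
isAv123-∷⁻ x σ av with elem x σ | has12Above x σ | isAv123 σ | av
... | false | false | true | _ = refl , refl , refl

at-injective : ∀ π a b x → isAv123 π ≡ true → at π a ≡ x → at π b ≡ x → 1 ≤ x → a ≡ b
at-injective []      a             b             x av refl _    ()
at-injective (y ∷ σ) zero          b             x av refl _    ()
at-injective (y ∷ σ) (suc a)       zero          x av _    refl ()
at-injective (y ∷ σ) (suc zero)    (suc zero)    x av _    _    _   = refl
at-injective (y ∷ σ) (suc zero)    (suc (suc b)) x av refl at≡y 1≤y =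
  ⊥-elim (false≢true (trans (sym (proj₁ (isAv123-∷⁻ y σ av))) (at→elem σ (suc b) y at≡y 1≤y)))
at-injective (y ∷ σ) (suc (suc a)) (suc zero)    x av at≡y refl 1≤y =
  ⊥-elim (false≢true (trans (sym (proj₁ (isAv123-∷⁻ y σ av))) (at→elem σ (suc a) y at≡y 1≤y)))
at-injective (y ∷ σ) (suc (suc a)) (suc (suc b)) x av at≡x at≡x′ 1≤x =
  cong suc (at-injective σ (suc a) (suc b) x (proj₂ (proj₂ (isAv123-∷⁻ y σ av))) at≡x at≡x′ 1≤x)

private
  occurrences-absent : ∀ x σ → elem x σ ≡ false → count (λ z → x ≡ᵇ z) σ ≡ 0
  occurrences-absent x []      _      = refl
  occurrences-absent x (y ∷ σ) x∉ with ∨-false {x ≡ᵇ y} x∉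
  ... | x≢y , x∉σ = trans (count-∷ (λ z → x ≡ᵇ z) y σ) (cong₂ (λ u v → indicator u + v) x≢y (occurrences-absent x σ x∉σ))

  occurrences-≤1 : ∀ v σ → isAv123 σ ≡ true → count (λ z → v ≡ᵇ z) σ ≤ 1
  occurrences-≤1 v []      _  = z≤n
  occurrences-≤1 v (y ∷ σ) av rewrite count-∷ (λ z → v ≡ᵇ z) y σ with v ≡ᵇ y in v≡y | isAv123-∷⁻ y σ av
  ... | true  | y∉σ , _ , _  rewrite ≡ᵇ-sound {v} {y} v≡y | occurrences-absent y σ y∉σ = s≤s z≤n
  ... | false | _ , _ , avσ = occurrences-≤1 v σ avσ

  length≡sum-occurrences : ∀ m σ → all (inRange m) σ ≡ true → length σ ≡ sumValues m (λ v → count (λ z → v ≡ᵇ z) σ)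
  length≡sum-occurrences m []      _   = sym (sumValues-zero m)
  length≡sum-occurrences m (y ∷ σ) inσ = begin
    suc (length σ)                                                        ≡⟨ cong suc (length≡sum-occurrences m σ (∧-elimʳ {inRange m y} inσ)) ⟩
    1 + sumValues m (λ v → count (λ z → v ≡ᵇ z) σ)                         ≡⟨ cong (_+ _) (sym single) ⟩
    sumValues m (λ v → indicator (v ≡ᵇ y)) + sumValues m (λ v → count (λ z → v ≡ᵇ z) σ)
                                                                          ≡⟨ sym (sumValues-+ m _ _) ⟩
    sumValues m (λ v → indicator (v ≡ᵇ y) + count (λ z → v ≡ᵇ z) σ)       ≡⟨ sumValues-cong m (λ v _ _ → sym (count-∷ (λ z → v ≡ᵇ z) y σ)) ⟩
    sumValues m (λ v → count (λ z → v ≡ᵇ z) (y ∷ σ))                      ∎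
    where
    open ≡-Reasoning
    y∈ : inRange m y ≡ true
    y∈ = ∧-elimˡ inσ
    single : sumValues m (λ v → indicator (v ≡ᵇ y)) ≡ 1
    single = trans (sumValues-cong m (λ v _ _ → cong indicator (≡ᵇ-sym v y)))
                   (countValues-single m y (<ᵇ-sound (∧-elimˡ y∈)) (≤-pred (<ᵇ-sound (∧-elimʳ {0 <ᵇ y} y∈))))

  length-≤-range : ∀ m σ → all (inRange m) σ ≡ true → isAv123 σ ≡ true → length σ ≤ m
  length-≤-range m σ inσ av =
    subst (_≤ m) (sym (length≡sum-occurrences m σ inσ)) (sumValues-≤ m _ (λ v → occurrences-≤1 v σ av))

  inRange-drop-top : ∀ M σ → all (inRange (suc M)) σ ≡ true → elem (suc M) σ ≡ false → all (inRange M) σ ≡ true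
  inRange-drop-top M []      _   _  = refl
  inRange-drop-top M (y ∷ σ) inσ N∉ with ∨-false {suc M ≡ᵇ y} N∉
  ... | N≢y , N∉σ = cong₂ _∧_ (cong₂ _∧_ (∧-elimˡ (∧-elimˡ inσ)) (<ᵇ-true {y} {suc M} below))
                              (inRange-drop-top M σ (∧-elimʳ {inRange (suc M) y} inσ) N∉σ)
    where
    y≤N : y ≤ suc M
    y≤N = ≤-pred (<ᵇ-sound {y} (∧-elimʳ {0 <ᵇ y} (∧-elimˡ inσ)))
    below : y < suc M
    below with m≤n⇒m<n∨m≡n y≤N
    ... | inj₁ y<N = y<N
    ... | inj₂ refl = ⊥-elim (false≢true (trans (sym N≢y) (≡ᵇ-refl (suc M))))

-- by pigeonhole
top-occurs : ∀ M π → length π ≡ suc M → all (inRange (suc M)) π ≡ true → isAv123 π ≡ true → elem (suc M) π ≡ true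
top-occurs M π len inπ av with elem (suc M) π in N∈
... | true  = refl
... | false = ⊥-elim (<-irrefl refl (≤-trans (≤-reflexive (sym len)) (length-≤-range M π (inRange-drop-top M π inπ N∈) av)))

decreasing : List ℕ → Bool
decreasing []       = true
decreasing (x ∷ xs) = all (_<ᵇ x) xs ∧ decreasing xs

private
  map-cong-all : ∀ (p : ℕ → Bool) (f g : ℕ → ℕ) xs → all p xs ≡ true → (∀ x → p x ≡ true → f x ≡ g x) → map f xs ≡ map g xs
  map-cong-all p f g []       _   _   = refl
  map-cong-all p f g (x ∷ xs) allp f≗g = cong₂ _∷_ (f≗g x (∧-elimˡ allp)) (map-cong-all p f g xs (∧-elimʳ {p x} allp) f≗g)

count-all : ∀ (p : ℕ → Bool) xs → all p xs ≡ true → count p xs ≡ length xs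
count-all p []       _   = refl
count-all p (x ∷ xs) allp = trans (count-∷ p x xs) (cong₂ (λ u v → indicator u + v) (∧-elimˡ allp) (count-all p xs (∧-elimʳ {p x} allp)))

count≡length⇒all : ∀ (p : ℕ → Bool) xs → count p xs ≡ length xs → all p xs ≡ true
count≡length⇒all p []       _ = refl
count≡length⇒all p (x ∷ xs) e = go (p x) refl (trans (sym (count-∷ p x xs)) e)
  where
  count≤length : count p xs ≤ length xs
  count≤length = subst (count p xs ≤_) (sym (length≡count-true xs)) (count-mono xs (λ _ _ → refl))
  go : ∀ b → p x ≡ b → indicator b + count p xs ≡ suc (length xs) → all p (x ∷ xs) ≡ true
  go true  px e rewrite px = count≡length⇒all p xs (suc-injective e)
  go false _  e = ⊥-elim (<-irrefl refl (≤-trans (≤-reflexive (sym e)) count≤length))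

ranks : List ℕ → ℕ → ℕ
ranks L x = suc (count (_<ᵇ x) L)

std-decreasing : ∀ xs → decreasing xs ≡ true → map (ranks xs) xs ≡ down (length xs)
std-decreasing []       _   = refl
std-decreasing (x ∷ xs) dec = cong₂ _∷_ head (trans tail (std-decreasing xs (∧-elimʳ {all (_<ᵇ x) xs} dec)))
  where
  head : ranks (x ∷ xs) x ≡ suc (length xs)
  head = cong suc (trans (count-∷ (_<ᵇ x) x xs) (cong₂ (λ u v → indicator u + v) (<ᵇ-irrefl x) (count-all (_<ᵇ x) xs (∧-elimˡ dec))))
  tail : map (ranks (x ∷ xs)) xs ≡ map (ranks xs) xs
  tail = map-cong-all (_<ᵇ x) _ _ xs (∧-elimˡ dec) (λ y y<x →
    cong suc (trans (count-∷ (_<ᵇ y) x xs) (cong (λ u → indicator u + count (_<ᵇ y) xs) (<ᵇ-false {x} {y} (<⇒≤ (<ᵇ-sound y<x))))))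

std-decreasing-∷ʳ-max : ∀ xs z → decreasing xs ≡ true → all (_<ᵇ z) xs ≡ true →
  std (xs ++ [ z ]) ≡ down (length xs) ++ [ suc (length xs) ]
std-decreasing-∷ʳ-max xs z dec below = begin
  map (ranks (xs ++ [ z ])) (xs ++ [ z ])                                   ≡⟨ map-++ _ xs [ z ] ⟩
  map (ranks (xs ++ [ z ])) xs ++ [ ranks (xs ++ [ z ]) z ]                 ≡⟨ cong₂ (λ u v → u ++ [ v ]) earlier last ⟩
  map (ranks xs) xs ++ [ suc (length xs) ]                                 ≡⟨ cong (_++ [ suc (length xs) ]) (std-decreasing xs dec) ⟩
  down (length xs) ++ [ suc (length xs) ]                                  ∎
  where
  open ≡-Reasoning
  z-ignored : ∀ y → (z <ᵇ y) ≡ false → count (_<ᵇ y) (xs ++ [ z ]) ≡ count (_<ᵇ y) xs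
  z-ignored y z≮y = trans (count-++ (_<ᵇ y) xs [ z ])
    (trans (cong (count (_<ᵇ y) xs +_) (trans (count-∷ (_<ᵇ y) z []) (cong (λ u → indicator u + 0) z≮y))) (+-identityʳ _))
  earlier : map (ranks (xs ++ [ z ])) xs ≡ map (ranks xs) xs
  earlier = map-cong-all (_<ᵇ z) _ _ xs below (λ y y<z → cong suc (z-ignored y (<ᵇ-false {z} {y} (<⇒≤ (<ᵇ-sound y<z)))))
  last : ranks (xs ++ [ z ]) z ≡ suc (length xs)
  last = cong suc (trans (z-ignored z (<ᵇ-irrefl z)) (count-all (_<ᵇ z) xs below))

take-at : ∀ π k → 1 ≤ k → k ≤ length π → take k π ≡ take (k ∸ 1) π ++ [ at π k ]
take-at (x ∷ π) (suc zero)    _ _        = refl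
take-at (x ∷ π) (suc (suc k)) _ (s≤s le) = cong (x ∷_) (take-at π (suc k) (s≤s z≤n) le)

length-take-≤ : ∀ k (π : List ℕ) → k ≤ length π → length (take k π) ≡ k
length-take-≤ zero    π       _        = refl
length-take-≤ (suc k) (x ∷ π) (s≤s le) = cong suc (length-take-≤ k π le)

take-take-≤ : ∀ j m (π : List ℕ) → j ≤ m → take j (take m π) ≡ take j π
take-take-≤ zero    m       π       _        = refl
take-take-≤ (suc j) (suc m) []      _        = refl
take-take-≤ (suc j) (suc m) (x ∷ π) (s≤s le) = cong (x ∷_) (take-take-≤ j m π le)

all-take : ∀ (p : ℕ → Bool) k σ → all p σ ≡ true → all p (take k σ) ≡ true
all-take p zero    σ       _   = refl
all-take p (suc k) []      _   = refl
all-take p (suc k) (x ∷ σ) allp = cong₂ _∧_ (∧-elimˡ allp) (all-take p k σ (∧-elimʳ {p x} allp))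

decreasing-take : ∀ k xs → decreasing xs ≡ true → decreasing (take k xs) ≡ true
decreasing-take zero    xs       _   = refl
decreasing-take (suc k) []       _   = refl
decreasing-take (suc k) (x ∷ xs) dec =
  cong₂ _∧_ (all-take _ k xs (∧-elimˡ dec)) (decreasing-take k xs (∧-elimʳ {all (_<ᵇ x) xs} dec))

at-take : ∀ i m (π : List ℕ) → 1 ≤ i → i ≤ m → at (take m π) i ≡ at π i
at-take (suc zero)    (suc m)       []      _ _        = refl
at-take (suc zero)    (suc m)       (x ∷ π) _ _        = refl
at-take (suc (suc i)) (suc m)       []      _ _        = refl
at-take (suc (suc i)) (suc (suc m)) (x ∷ π) _ (s≤s le) = at-take (suc i) (suc m) π (s≤s z≤n) le

at-range : ∀ π i x → at π i ≡ x → 1 ≤ x → (1 ≤ i) × (i ≤ length π)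
at-range []      i             x refl ()
at-range (y ∷ π) zero          x refl ()
at-range (y ∷ π) (suc zero)    x _    _   = s≤s z≤n , s≤s z≤n
at-range (y ∷ π) (suc (suc i)) x at≡x 1≤x = s≤s z≤n , s≤s (proj₂ (at-range π (suc i) x at≡x 1≤x))

at→anyAbove : ∀ σ c z w → at σ c ≡ z → w < z → anyAbove w σ ≡ true
at→anyAbove []      c             z w refl w<z = ⊥-elim (n≮0 w<z)
at→anyAbove (y ∷ σ) zero          z w refl w<z = ⊥-elim (n≮0 w<z)
at→anyAbove (y ∷ σ) (suc zero)    z w refl w<z = ∨-introˡ (anyAbove w σ) (<ᵇ-true w<z)
at→anyAbove (y ∷ σ) (suc (suc c)) z w at≡z w<z = ∨-introʳ (w <ᵇ y) (at→anyAbove σ (suc c) z w at≡z w<z)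

at→has12Above : ∀ σ b c y z t → at σ b ≡ y → at σ c ≡ z → 1 ≤ b → b < c → t < y → y < z → has12Above t σ ≡ true
at→has12Above []      b             c             y z t refl _ _ _ t<y _ = ⊥-elim (n≮0 t<y)
at→has12Above (w ∷ σ) (suc zero)    (suc (suc c)) y z t refl at≡z _ _ t<y y<z =
  ∨-introˡ (has12Above t σ) (cong₂ _∧_ (<ᵇ-true t<y) (at→anyAbove σ (suc c) z w at≡z y<z))
at→has12Above (w ∷ σ) (suc (suc b)) (suc (suc (suc c))) y z t at≡y at≡z _ (s≤s b<c) t<y y<z =
  ∨-introʳ ((t <ᵇ w) ∧ anyAbove w σ) (at→has12Above σ (suc b) (suc (suc c)) y z t at≡y at≡z (s≤s z≤n) b<c t<y y<z)
at→has12Above (w ∷ σ) (suc zero)    (suc zero)          y z t _ _ _ (s≤s ()) _ _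
at→has12Above (w ∷ σ) (suc (suc b)) (suc zero)          y z t _ _ _ (s≤s ()) _ _
at→has12Above (w ∷ σ) (suc (suc b)) (suc (suc zero))    y z t _ _ _ (s≤s (s≤s ())) _ _

at→¬isAv123 : ∀ π a b c x y z → at π a ≡ x → at π b ≡ y → at π c ≡ z → 1 ≤ a → a < b → b < c → 1 ≤ x → x < y → y < z →
  isAv123 π ≡ false
at→¬isAv123 []      a b c x y z refl _ _ _ _ _ () _ _
at→¬isAv123 (w ∷ σ) (suc zero) (suc (suc b)) (suc (suc c)) x y z refl at≡y at≡z _ _ (s≤s (s≤s b<c)) _ x<y y<z
  rewrite at→has12Above σ (suc b) (suc c) y z w at≡y at≡z (s≤s z≤n) (s≤s b<c) x<y y<z = ∧-zeroʳ (not (elem w σ))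
at→¬isAv123 (w ∷ σ) (suc (suc a)) (suc (suc b)) (suc (suc c)) x y z at≡x at≡y at≡z _ (s≤s a<b) (s≤s b<c) 1≤x x<y y<z
  rewrite at→¬isAv123 σ (suc a) (suc b) (suc c) x y z at≡x at≡y at≡z (s≤s z≤n) a<b b<c 1≤x x<y y<z
        | ∧-zeroʳ (not (has12Above w σ)) = ∧-zeroʳ (not (elem w σ))
at→¬isAv123 (w ∷ σ) zero b c x y z _ _ _ () _ _ _ _ _
at→¬isAv123 (w ∷ σ) a zero c x y z _ _ _ _ () _ _ _ _
at→¬isAv123 (w ∷ σ) a (suc b) zero x y z _ _ _ _ _ () _ _ _
at→¬isAv123 (w ∷ σ) (suc zero) (suc zero) c x y z _ _ _ _ (s≤s ()) _ _ _ _
at→¬isAv123 (w ∷ σ) (suc zero) (suc (suc b)) (suc zero) x y z _ _ _ _ _ (s≤s ()) _ _ _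
at→¬isAv123 (w ∷ σ) (suc (suc a)) (suc zero) c x y z _ _ _ _ (s≤s ()) _ _ _ _
at→¬isAv123 (w ∷ σ) (suc (suc a)) (suc (suc b)) (suc zero) x y z _ _ _ _ _ (s≤s ()) _ _ _

inRange-pos : ∀ N x → inRange N x ≡ true → 1 ≤ x
inRange-pos N x x∈ = <ᵇ-sound (∧-elimˡ x∈)

inRange-≤ : ∀ N x → inRange N x ≡ true → x ≤ N
inRange-≤ N x x∈ = ≤-pred (<ᵇ-sound {x} {suc N} (∧-elimʳ {0 <ᵇ x} x∈))

at-inRange : ∀ N π i → all (inRange N) π ≡ true → 1 ≤ i → i ≤ length π → inRange N (at π i) ≡ true
at-inRange N (x ∷ π) (suc zero)    inπ _ _        = ∧-elimˡ inπ
at-inRange N (x ∷ π) (suc (suc i)) inπ _ (s≤s le) = at-inRange N π (suc i) (∧-elimʳ {inRange N x} inπ) (s≤s z≤n) le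

all-∧-intro : ∀ {p q : ℕ → Bool} σ → all p σ ≡ true → all q σ ≡ true → all (λ z → p z ∧ q z) σ ≡ true
all-∧-intro {p} {q} σ allp allq = trans (all-∧ p q σ) (cong₂ _∧_ allp allq)

private
  -- no entry between x and N may precede N, or x, it and N would form a 123
  none-between : ∀ x σ k N → has12Above x σ ≡ false → at σ (suc k) ≡ N → all (λ w → not ((x <ᵇ w) ∧ (w <ᵇ N))) (take k σ) ≡ true
  none-between x σ       zero    N _   _    = refl
  none-between x []      (suc k) N _   _    = refl
  none-between x (w ∷ σ) (suc k) N x12 at≡N with ∨-false {(x <ᵇ w) ∧ anyAbove w σ} x12
  ... | x₁₂ , rest = cong₂ _∧_ head (none-between x σ k N rest at≡N)
    where
    head : not ((x <ᵇ w) ∧ (w <ᵇ N)) ≡ true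
    head with w <ᵇ N in w<N
    ... | false = cong not (∧-zeroʳ (x <ᵇ w))
    ... | true with x <ᵇ w in x<w
    ...   | false = refl
    ...   | true  = ⊥-elim (false≢true (trans (sym x₁₂) (at→anyAbove σ (suc k) N w at≡N (<ᵇ-sound w<N))))

before-max-decreasing : ∀ π k N → isAv123 π ≡ true → all (inRange N) π ≡ true → at π k ≡ N → 1 ≤ k → 1 ≤ N →
  (decreasing (take (k ∸ 1) π) ≡ true) × (all (_<ᵇ N) (take (k ∸ 1) π) ≡ true)
before-max-decreasing []      k             N av inπ refl _ ()
before-max-decreasing (x ∷ σ) (suc zero)    N av inπ at≡N _ _   = refl , refl
before-max-decreasing (x ∷ σ) (suc (suc k)) N av inπ at≡N _ 1≤N with isAv123-∷⁻ x σ av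
... | x∉σ , x12 , avσ with before-max-decreasing σ (suc k) N avσ (∧-elimʳ {inRange N x} inπ) at≡N (s≤s z≤n) 1≤N
...   | dec , below = cong₂ _∧_ belowX dec , cong₂ _∧_ (<ᵇ-true x<N) below
  where
  belowX : all (_<ᵇ x) (take k σ) ≡ true
  belowX = all-mono (take k σ) pointwise
    (all-∧-intro (take k σ) (all-∧-intro (take k σ) (none-between x σ k N x12 at≡N) below)
                 (all-take _ k σ (trans (all-≢≡not-elem x σ) (cong not x∉σ))))
    where
    pointwise : ∀ z → (not ((x <ᵇ z) ∧ (z <ᵇ N)) ∧ (z <ᵇ N)) ∧ not (x ≡ᵇ z) ≡ true → (z <ᵇ x) ≡ true
    pointwise z h with <-cmp z x
    ... | tri< z<x _ _ = <ᵇ-true z<x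
    ... | tri≈ _ refl _ rewrite ≡ᵇ-refl z = ⊥-elim (false≢true (∧-elimʳ {not ((z <ᵇ z) ∧ (z <ᵇ N)) ∧ (z <ᵇ N)} h))
    ... | tri> _ _ x<z rewrite <ᵇ-true x<z with z <ᵇ N | h
    ...   | true  | ()
    ...   | false | ()
  x<N : x < N
  x<N with <-cmp x N
  ... | tri< x<N _ _ = x<N
  ... | tri≈ _ refl _ = ⊥-elim (false≢true (trans (sym x∉σ) (at→elem σ (suc k) x at≡N 1≤N)))
  ... | tri> _ _ N<x = ⊥-elim (<-irrefl refl (≤-trans N<x (inRange-≤ N x (∧-elimˡ inπ))))

restrict-at-max : ∀ π k N → isAv123 π ≡ true → all (inRange N) π ≡ true → length π ≡ N → at π k ≡ N → 1 ≤ k → k ≤ N →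
  restrict π k ≡ staircase k
restrict-at-max π (suc k) N av inπ len at≡N _ k<N with before-max-decreasing π (suc k) N av inπ at≡N (s≤s z≤n) (≤-trans (s≤s z≤n) k<N)
... | dec , below = begin
  std (take (suc k) π)                                      ≡⟨ cong std (take-at π (suc k) (s≤s z≤n) k<len) ⟩
  std (take k π ++ [ at π (suc k) ])                        ≡⟨ cong (λ z → std (take k π ++ [ z ])) at≡N ⟩
  std (take k π ++ [ N ])                                   ≡⟨ std-decreasing-∷ʳ-max (take k π) N dec below ⟩
  down (length (take k π)) ++ [ suc (length (take k π)) ]   ≡⟨ cong (λ m → down m ++ [ suc m ]) (length-take-≤ k π (<⇒≤ k<len)) ⟩
  down k ++ [ suc k ]                                       ∎
  where
  open ≡-Reasoning
  k<len : suc k ≤ length π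
  k<len = subst (suc k ≤_) (sym len) k<N

==L-true : ∀ p q → p ≡ q → (p ==L q) ≡ true
==L-true p q p≡q with ≡-dec _≟_ p q
... | yes _  = refl
... | no p≢q = ⊥-elim (p≢q p≡q)

==L-sound : ∀ p q → (p ==L q) ≡ true → p ≡ q
==L-sound p q e with ≡-dec _≟_ p q
... | yes p≡q = p≡q

restrict-1 : ∀ x σ → restrict (x ∷ σ) 1 ≡ [ 1 ]
restrict-1 x σ = cong (λ u → [ suc u ]) (trans (count-∷ (_<ᵇ x) x []) (cong (λ u → indicator u + 0) (<ᵇ-irrefl x)))

-- A staircase prefix of size k ≥ 2 ends with an entry exceeding all earlier ones, the first among
-- them; were N later, these three entries would form a 123.
max-at-staircase : ∀ π k M → isAv123 π ≡ true → all (inRange (suc M)) π ≡ true → length π ≡ suc M → 2 ≤ k → k ≤ suc M →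
  restrict π k ≡ staircase k → at π k ≡ suc M
max-at-staircase π (suc k) M av inπ len 2≤k k<N stair = z≡N
  where
  N : ℕ
  N = suc M
  ys : List ℕ
  ys = take k π
  z : ℕ
  z = at π (suc k)
  k<len : suc k ≤ length π
  k<len = subst (suc k ≤_) (sym len) k<N
  std≡ : map (ranks (ys ++ [ z ])) ys ++ [ ranks (ys ++ [ z ]) z ] ≡ down k ++ [ suc k ]
  std≡ = trans (sym (map-++ _ ys [ z ])) (trans (cong std (sym (take-at π (suc k) (s≤s z≤n) k<len))) stair)
  rank-z : count (_<ᵇ z) ys ≡ length ys
  rank-z = begin
    count (_<ᵇ z) ys                            ≡⟨ sym (+-identityʳ _) ⟩
    count (_<ᵇ z) ys + 0                        ≡⟨ cong (count (_<ᵇ z) ys +_) (sym z-last) ⟩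
    count (_<ᵇ z) ys + count (_<ᵇ z) [ z ]      ≡⟨ sym (count-++ (_<ᵇ z) ys [ z ]) ⟩
    count (_<ᵇ z) (ys ++ [ z ])                 ≡⟨ suc-injective (∷ʳ-injectiveʳ _ _ std≡) ⟩
    k                                           ≡⟨ sym (length-take-≤ k π (<⇒≤ k<len)) ⟩
    length ys                                   ∎
    where
    open ≡-Reasoning
    z-last : count (_<ᵇ z) [ z ] ≡ 0
    z-last = trans (count-∷ (_<ᵇ z) z []) (cong (λ u → indicator u + 0) (<ᵇ-irrefl z))
  all-below-z : all (_<ᵇ z) ys ≡ true
  all-below-z = count≡length⇒all _ ys rank-z
  below-z : ∀ i → 1 ≤ i → i ≤ k → 1 ≤ at π i → at π i < z
  below-z i 1≤i i≤k pos = <ᵇ-sound (all-at _ ys i (at π i) all-below-z (at-take i k π 1≤i i≤k) pos)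
  z≤N : z ≤ N
  z≤N = inRange-≤ N z (at-inRange N π (suc k) inπ (s≤s z≤n) k<len)
  first-pos : 1 ≤ at π 1
  first-pos = inRange-pos N _ (at-inRange N π 1 inπ (s≤s z≤n) (≤-trans (s≤s z≤n) k<len))
  z≡N : z ≡ N
  z≡N with elem→at π N (top-occurs M π len inπ av)
  ... | i , 1≤i , at≡N with <-cmp i (suc k)
  ...   | tri≈ _ refl _ = at≡N
  ...   | tri< i<k _ _  = ⊥-elim (<-irrefl refl (≤-<-trans z≤N (subst (_< z) at≡N (below-z i 1≤i (≤-pred i<k) (subst (1 ≤_) (sym at≡N) (s≤s z≤n))))))
  ...   | tri> _ _ k<i with m≤n⇒m<n∨m≡n z≤N
  ...     | inj₂ z≡N = z≡N
  ...     | inj₁ z<N = ⊥-elim (false≢true (trans (sym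
              (at→¬isAv123 π 1 (suc k) i (at π 1) z N refl refl at≡N (s≤s z≤n) 2≤k k<i first-pos (below-z 1 (s≤s z≤n) (≤-pred 2≤k) first-pos) z<N))
              av))

staircase-prefix≡top-at : ∀ π k M → isAv123 π ≡ true → all (inRange (suc M)) π ≡ true → length π ≡ suc M → 2 ≤ k → k ≤ suc M →
  (restrict π k ==L staircase k) ≡ (at π k ≡ᵇ suc M)
staircase-prefix≡top-at π k M av inπ len 2≤k k≤N with at π k ≡ᵇ suc M in top
... | true  = ==L-true _ _ (restrict-at-max π k (suc M) av inπ len (≡ᵇ-sound top) (≤-trans (s≤s z≤n) 2≤k) k≤N)
... | false with restrict π k ==L staircase k in stair
...   | false = refl
...   | true  = ⊥-elim (false≢true (trans (sym top) (trans (cong (_≡ᵇ suc M) (max-at-staircase π k M av inπ len 2≤k k≤N (==L-sound _ _ stair)))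
                                                          (≡ᵇ-refl (suc M)))))

-- The game

consecutive : ℕ → ℕ → List ℕ
consecutive s zero    = []
consecutive s (suc m) = s ∷ consecutive (suc s) m

private
  applyUpTo-shift : ∀ m s (f : ℕ → ℕ) → (∀ x → f x ≡ s + x) → applyUpTo f m ≡ consecutive s m
  applyUpTo-shift zero    s f f≗ = refl
  applyUpTo-shift (suc m) s f f≗ =
    cong₂ _∷_ (trans (f≗ 0) (+-identityʳ s)) (applyUpTo-shift m (suc s) (λ x → f (suc x)) (λ x → trans (f≗ (suc x)) (+-suc s x)))

candidates≡consecutive : ∀ M → map suc (upTo M) ≡ consecutive 1 M
candidates≡consecutive M = trans (map-applyUpTo (λ x → x) suc M) (applyUpTo-shift M 1 suc (λ x → refl))

find-first : ∀ m s i (p : ℕ → Bool) → s ≤ i → i ≤ s + m → (∀ j → s ≤ j → j < i → p j ≡ false) → (i < s + m → p i ≡ true) →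
  fromMaybe (s + m) (findᵇ p (consecutive s m)) ≡ i
find-first zero    s i p s≤i i≤s _ _ = trans (+-identityʳ s) (≤-antisym s≤i (≤-trans i≤s (≤-reflexive (+-identityʳ s))))
find-first (suc m) s i p s≤i i≤s+m before at-i with m≤n⇒m<n∨m≡n s≤i
... | inj₂ refl rewrite at-i (m<m+n s (s≤s z≤n)) = refl
... | inj₁ s<i rewrite before s ≤-refl s<i | +-suc s m =
  find-first m (suc s) i p s<i i≤s+m (λ j s<j j<i → before j (≤-trans (n≤1+n s) s<j) j<i) at-i

private
  findᵇ-sound : ∀ (p : ℕ → Bool) xs v → findᵇ p xs ≡ just v → p v ≡ true
  findᵇ-sound p (x ∷ xs) v found with p x in px
  ... | true  with found
  ...   | refl = px
  findᵇ-sound p (x ∷ xs) v found | false = findᵇ-sound p xs v found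

accepted-1 : ∀ (σ : Strategy) N π → 2 ≤ N → accepted σ N π ≡ 1 → σ (restrict π 1) ≡ true
accepted-1 σ N π 2≤N acc with findᵇ (λ i → σ (restrict π i)) (map suc (upTo (N ∸ 1))) in found
... | just v  rewrite acc = findᵇ-sound (λ i → σ (restrict π i)) (map suc (upTo (N ∸ 1))) 1 found
... | nothing rewrite acc = ⊥-elim (<-irrefl refl 2≤N)

accepted-first : ∀ M (τ : Strategy) x σ → τ [ 1 ] ≡ true → accepted τ (suc (suc M)) (x ∷ σ) ≡ 1
accepted-first M τ x σ accept rewrite restrict-1 x σ | accept = refl

private
  lrmFrom-down : ∀ j m → j ≤ m → ∀ ys → lrmFrom m (down j ++ ys) ≡ lrmFrom m ys
  lrmFrom-down zero    m _  ys = refl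
  lrmFrom-down (suc j) m le ys rewrite <ᵇ-false {m} {suc j} le = lrmFrom-down j m (≤-trans (n≤1+n j) le) ys

  all-down : ∀ j m → j < m → all (_<ᵇ m) (down j) ≡ true
  all-down zero    m _  = refl
  all-down (suc j) m lt = cong₂ _∧_ (<ᵇ-true lt) (all-down j m (≤-trans (n≤1+n (suc j)) lt))

  all-++ : ∀ (p : ℕ → Bool) xs ys → all p (xs ++ ys) ≡ all p xs ∧ all p ys
  all-++ p []       ys = refl
  all-++ p (x ∷ xs) ys = trans (cong (p x ∧_) (all-++ p xs ys)) (sym (∧-assoc (p x) _ _))

  all-reverse : ∀ (p : ℕ → Bool) xs → all p xs ≡ true → all p (reverse xs) ≡ true
  all-reverse p []       _   = refl
  all-reverse p (x ∷ xs) allp = trans (cong (all p) (unfold-reverse x xs))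
    (trans (all-++ p (reverse xs) [ x ]) (cong₂ _∧_ (all-reverse p xs (∧-elimʳ {p x} allp)) (cong (_∧ true) (∧-elimˡ allp))))

  lastIsLRMax-reverse : ∀ q x rest → reverse q ≡ x ∷ rest → lastIsLRMax q ≡ all (_<ᵇ x) rest
  lastIsLRMax-reverse q x rest rev with reverse q
  ... | y ∷ r with rev
  ...   | refl = refl

secondLRMax-down : ∀ j → secondLRMax (down (suc j)) ≡ false
secondLRMax-down j rewrite sym (++-identityʳ (down j)) | lrmFrom-down j (suc j) (n≤1+n j) [] = ∧-zeroʳ _

secondLRMax-staircase : ∀ i → secondLRMax (staircase (suc (suc i))) ≡ true
secondLRMax-staircase i = cong₂ _∧_
  (trans (lastIsLRMax-reverse (down (suc i) ++ [ suc (suc i) ]) (suc (suc i)) (reverse (down (suc i))) (reverse-++ (down (suc i)) [ suc (suc i) ]))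
         (all-reverse _ (down (suc i)) (all-down (suc i) (suc (suc i)) ≤-refl)))
  (cong (_≡ᵇ 2) (cong suc (trans (lrmFrom-down i (suc i) (n≤1+n i) [ suc (suc i) ])
                                 (cong (λ b → if b then 1 else 0) (<ᵇ-true {suc i} {suc (suc i)} ≤-refl)))))

secondLRMax-staircase-prefix : ∀ π i → restrict π i ≡ staircase i → 2 ≤ i → secondLRMax (restrict π i) ≡ true
secondLRMax-staircase-prefix π (suc (suc i)) stair _ = trans (cong secondLRMax stair) (secondLRMax-staircase i)
secondLRMax-staircase-prefix π (suc zero)    _     (s≤s ())

module Game (M : ℕ) (1≤M : 1 ≤ M) where

  N : ℕ
  N = suc M

  accepted-secondLRMax : ∀ π i → isAv123 π ≡ true → all (inRange N) π ≡ true → length π ≡ N → at π i ≡ N → 2 ≤ i →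
    accepted secondLRMax N π ≡ i
  accepted-secondLRMax π i av inπ len at≡N 2≤i =
    trans (cong (λ l → fromMaybe N (findᵇ (λ j → secondLRMax (restrict π j)) l)) (candidates≡consecutive M))
          (find-first M 1 i _ (≤-trans (s≤s z≤n) 2≤i) (subst (i ≤_) len i≤len) before at-i)
    where
    i≤len : i ≤ length π
    i≤len = proj₂ (at-range π i N at≡N (s≤s z≤n))
    decreasing-before : decreasing (take (i ∸ 1) π) ≡ true
    decreasing-before = proj₁ (before-max-decreasing π i N av inπ at≡N (≤-trans (s≤s z≤n) 2≤i) (s≤s z≤n))
    before : ∀ j → 1 ≤ j → j < i → secondLRMax (restrict π j) ≡ false
    before (suc j) _ j<i = trans (cong secondLRMax prefix-down) (secondLRMax-down j)
      where
      j<i∸1 : suc j ≤ i ∸ 1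
      j<i∸1 = subst (suc j ≤_) (pred[m∸n]≡m∸[1+n] i 0) (<⇒≤pred j<i)
      prefix-down : restrict π (suc j) ≡ down (suc j)
      prefix-down = trans (std-decreasing (take (suc j) π)
                            (subst (λ l → decreasing l ≡ true) (take-take-≤ (suc j) (i ∸ 1) π j<i∸1)
                                   (decreasing-take (suc j) (take (i ∸ 1) π) decreasing-before)))
                          (cong down (length-take-≤ (suc j) π (≤-trans (<⇒≤ j<i) i≤len)))
    at-i : i < 1 + M → secondLRMax (restrict π i) ≡ true
    at-i _ = secondLRMax-staircase-prefix π i (restrict-at-max π i N av inπ len at≡N (≤-trans (s≤s z≤n) 2≤i) (subst (i ≤_) len i≤len)) 2≤i

  secondLRMax-wins : ∀ π → isAv123 π ≡ true → all (inRange N) π ≡ true → length π ≡ N →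
    (at π (accepted secondLRMax N π) ≡ᵇ N) ≡ not (at π 1 ≡ᵇ N)
  secondLRMax-wins π av inπ len with at π 1 ≡ᵇ N in first
  ... | false with elem→at π N (top-occurs M π len inπ av)
  ...   | suc zero , _ , at≡N = ⊥-elim (false≢true (trans (sym first) (trans (cong (_≡ᵇ N) at≡N) (≡ᵇ-refl N))))
  ...   | suc (suc i) , _ , at≡N =
    trans (cong (λ a → at π a ≡ᵇ N) (accepted-secondLRMax π (suc (suc i)) av inπ len at≡N (s≤s (s≤s z≤n))))
          (trans (cong (_≡ᵇ N) at≡N) (≡ᵇ-refl N))
  secondLRMax-wins (x ∷ σ) av inπ len | true with at (x ∷ σ) (accepted secondLRMax N (x ∷ σ)) ≡ᵇ N in win
  ...   | false = refl
  ...   | true  = ⊥-elim (false≢true (trans (cong secondLRMax (sym (restrict-1 x σ)))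
                     (accepted-1 secondLRMax N (x ∷ σ) (s≤s 1≤M) (at-injective (x ∷ σ) _ 1 N av (≡ᵇ-sound win) (≡ᵇ-sound first) (s≤s z≤n)))))

  wins-only-later : ∀ (τ : Strategy) π → τ [ 1 ] ≡ false → isAv123 π ≡ true →
    (at π (accepted τ N π) ≡ᵇ N) ≡ true → not (at π 1 ≡ᵇ N) ≡ true
  wins-only-later τ π reject av win with at π 1 ≡ᵇ N in first
  ... | false = refl
  wins-only-later τ (x ∷ σ) reject av win | true =
    ⊥-elim (false≢true (trans (sym reject) (trans (cong τ (sym (restrict-1 x σ)))
      (accepted-1 τ N (x ∷ σ) (s≤s 1≤M) (at-injective (x ∷ σ) _ 1 N av (≡ᵇ-sound win) (≡ᵇ-sound first) (s≤s z≤n))))))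

-- The limit 3/4

-- With X = C (M + 1), Y = C M and W = X - Y, the identity (M + 2) X = 2 (2M + 1) Y gives
-- (M + 2)(3X - 4W) = (M + 2)(4Y - X) = 6Y, so 3X - 4W is small compared with X.
module WinRatio (M X Y W : ℕ) (rel : suc (suc M) * X ≡ 2 * suc (2 * M) * Y) (split : W + Y ≡ X) where

  K : ℕ
  K = suc (suc M)

  X≤4Y : X ≤ 4 * Y
  X≤4Y = *-cancelˡ-≤ K (begin
    K * X                   ≡⟨ rel ⟩
    2 * suc (2 * M) * Y     ≤⟨ *-monoˡ-≤ Y (≤-trans (≤-reflexive (double M)) (m≤m+n _ 6)) ⟩
    (suc (suc (4 * M)) + 6) * Y ≡⟨ regroup M Y ⟩
    K * (4 * Y)             ∎)
    where
    open ≤-Reasoning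
    double : ∀ M → 2 * suc (2 * M) ≡ suc (suc (4 * M))
    double = solve-∀
    regroup : ∀ M Y → (suc (suc (4 * M)) + 6) * Y ≡ suc (suc M) * (4 * Y)
    regroup = solve-∀
  4W≤3X : 4 * W ≤ 3 * X
  4W≤3X = +-cancelʳ-≤ (4 * Y) _ _ (begin
    4 * W + 4 * Y     ≡⟨ sym (*-distribˡ-+ 4 W Y) ⟩
    4 * (W + Y)       ≡⟨ cong (4 *_) split ⟩
    4 * X             ≡⟨ four X ⟩
    3 * X + X         ≤⟨ +-monoʳ-≤ (3 * X) X≤4Y ⟩
    3 * X + 4 * Y     ∎)
    where
    open ≤-Reasoning
    four : ∀ X → 4 * X ≡ 3 * X + X
    four = solve-∀
  Z : ℕ
  Z = 3 * X ∸ 4 * W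
  Z+X≡4Y : Z + X ≡ 4 * Y
  Z+X≡4Y = +-cancelʳ-≡ (4 * W) _ _ (begin
    (Z + X) + 4 * W     ≡⟨ swap Z X (4 * W) ⟩
    (Z + 4 * W) + X     ≡⟨ cong (_+ X) (m∸n+n≡m 4W≤3X) ⟩
    3 * X + X           ≡⟨ four X ⟩
    4 * X               ≡⟨ cong (4 *_) (sym split) ⟩
    4 * (W + Y)         ≡⟨ distrib W Y ⟩
    4 * Y + 4 * W       ∎)
    where
    open ≡-Reasoning
    swap : ∀ a b c → (a + b) + c ≡ (a + c) + b
    swap = solve-∀
    four : ∀ X → 3 * X + X ≡ 4 * X
    four = solve-∀
    distrib : ∀ W Y → 4 * (W + Y) ≡ 4 * Y + 4 * W
    distrib = solve-∀
  KZ≡6Y : K * Z ≡ 6 * Y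
  KZ≡6Y = +-cancelʳ-≡ (2 * suc (2 * M) * Y) _ _ (begin
    K * Z + 2 * suc (2 * M) * Y     ≡⟨ cong (λ v → K * Z + v) (sym rel) ⟩
    K * Z + K * X                   ≡⟨ sym (*-distribˡ-+ K Z X) ⟩
    K * (Z + X)                     ≡⟨ cong (K *_) Z+X≡4Y ⟩
    K * (4 * Y)                     ≡⟨ expand M Y ⟩
    6 * Y + 2 * suc (2 * M) * Y     ∎)
    where
    open ≡-Reasoning
    expand : ∀ M Y → suc (suc M) * (4 * Y) ≡ 6 * Y + 2 * suc (2 * M) * Y
    expand = solve-∀
  small : ∀ d → 1 ≤ Y → d ≤ M → Z * d < 4 * X
  small d 1≤Y d≤M = *-cancelˡ-< K _ _ (begin-strict
    K * (Z * d)             ≡⟨ sym (*-assoc K Z d) ⟩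
    K * Z * d               ≡⟨ cong (_* d) KZ≡6Y ⟩
    6 * Y * d               ≤⟨ *-monoʳ-≤ (6 * Y) d≤M ⟩
    6 * Y * M               ≡⟨ reorder Y M ⟩
    6 * M * Y + 0           <⟨ +-mono-≤-< (*-monoˡ-≤ Y (*-monoˡ-≤ M (m≤m+n 6 10))) (≤-trans 1≤Y (m≤n*m Y 8)) ⟩
    16 * M * Y + 8 * Y      ≡⟨ expand M Y ⟩
    4 * (2 * suc (2 * M) * Y) ≡⟨ cong (4 *_) (sym rel) ⟩
    4 * (K * X)             ≡⟨ commute K X ⟩
    K * (4 * X)             ∎)
    where
    open ≤-Reasoning
    reorder : ∀ Y M → 6 * Y * M ≡ 6 * M * Y + 0
    reorder = solve-∀
    expand : ∀ M Y → 16 * M * Y + 8 * Y ≡ 4 * (2 * suc (2 * M) * Y)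
    expand = solve-∀
    commute : ∀ K X → 4 * (K * X) ≡ K * (4 * X)
    commute = solve-∀

private
  +*+ : ∀ a m → (ℤ.+ a) ℤ.* (ℤ.+ m) ≡ ℤ.+ (a * m)
  +*+ a m = ℤ.+◃n≡+n (a * m)

÷-monoˡ-≤ : ∀ a b L → a ≤ b → a ÷ L ℚ.≤ b ÷ L
÷-monoˡ-≤ a b zero    _   = ℚ.≤-refl
÷-monoˡ-≤ a b (suc L) a≤b = ℚ.toℚᵘ-cancel-≤
  (ℚᵘ.≤-respˡ-≃ (ℚᵘ.≃-sym (ℚ.toℚᵘ-fromℚᵘ (ℚᵘ.mkℚᵘ (ℤ.+ a) L)))
  (ℚᵘ.≤-respʳ-≃ (ℚᵘ.≃-sym (ℚ.toℚᵘ-fromℚᵘ (ℚᵘ.mkℚᵘ (ℤ.+ b) L)))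
  (ℚᵘ.*≤* (subst₂ ℤ._≤_ (sym (+*+ a (suc L))) (sym (+*+ b (suc L))) (ℤ.+≤+ (*-monoˡ-≤ (suc L) a≤b))))))

private
  ∣W·4-3·X∣ : ∀ W X → 4 * W ≤ 3 * X → ℤ.∣ (ℤ.+ W) ℤ.* (ℤ.+ 4) ℤ.+ (ℤ.-[1+ 2 ]) ℤ.* (ℤ.+ X) ∣ ≡ 3 * X ∸ 4 * W
  ∣W·4-3·X∣ W X 4W≤3X = begin
    ℤ.∣ (ℤ.+ W) ℤ.* (ℤ.+ 4) ℤ.+ (ℤ.-[1+ 2 ]) ℤ.* (ℤ.+ X) ∣
      ≡⟨ cong₂ (λ u v → ℤ.∣ u ℤ.+ v ∣) (+*+ W 4) (trans (sym (ℤ.neg-distribˡ-* (ℤ.+ 3) (ℤ.+ X))) (cong ℤ.-_ (+*+ 3 X))) ⟩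
    ℤ.∣ ℤ.+ (W * 4) ℤ.+ ℤ.- (ℤ.+ (3 * X)) ∣ ≡⟨ cong ℤ.∣_∣ (ℤ.m-n≡m⊖n (W * 4) (3 * X)) ⟩
    ℤ.∣ (W * 4) ℤ.⊖ (3 * X) ∣               ≡⟨ ℤ.∣⊖∣-≤ (subst (_≤ 3 * X) (*-comm 4 W) 4W≤3X) ⟩
    3 * X ∸ W * 4                         ≡⟨ cong (3 * X ∸_) (*-comm W 4) ⟩
    3 * X ∸ 4 * W                         ∎
    where open ≡-Reasoning

-- |W/X - 3/4| = (3X - 4W)/(4X), which WinRatio.small bounds by ε = (k+1)/(d+1) once d ≤ M
close-to-3/4 : ∀ M X′ Y W (ε : ℚ.ℚ) → ℚ.0ℚ ℚ.< ε → ℚ.↧ₙ ε ≤ M → 1 ≤ Y →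
  suc (suc M) * suc X′ ≡ 2 * suc (2 * M) * Y → W + Y ≡ suc X′ →
  ℚ.∣ (W ÷ suc X′) ℚ.- (ℤ.+ 3) ℚ./ 4 ∣ ℚ.< ε
close-to-3/4 M X′ Y W (ℚ.mkℚ (ℤ.+ 0)     _ _) (ℚ.*<* 0<0) _ _ _ _ = ⊥-elim (ℤ.<-irrefl refl 0<0)
close-to-3/4 M X′ Y W (ℚ.mkℚ ℤ.-[1+ n ] _ _) (ℚ.*<* ())  _ _ _ _
close-to-3/4 M X′ Y W ε@(ℚ.mkℚ ℤ.+[1+ k ] d-1 _) _ d≤M 1≤Y rel split =
  ℚ.toℚᵘ-cancel-< (ℚᵘ.<-respˡ-≃ (ℚᵘ.≃-sym normalised) unnormalised)
  where
  X : ℕ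
  X = suc X′
  A B : ℚᵘ.ℚᵘ
  A = ℚᵘ.mkℚᵘ (ℤ.+ W) X′
  B = ℚᵘ.mkℚᵘ (ℤ.+ 3) 3
  normalised : ℚ.toℚᵘ ℚ.∣ (W ÷ X) ℚ.- (ℤ.+ 3) ℚ./ 4 ∣ ℚᵘ.≃ ℚᵘ.∣ A ℚᵘ.+ ℚᵘ.- B ∣
  normalised = ℚᵘ.≃-trans (ℚ.toℚᵘ-homo-∣-∣ ((W ÷ X) ℚ.- (ℤ.+ 3) ℚ./ 4)) (ℚᵘ.∣-∣-cong (ℚᵘ.≃-trans (ℚ.toℚᵘ-homo-+ (W ÷ X) (ℚ.- ((ℤ.+ 3) ℚ./ 4)))
                 (ℚᵘ.+-cong (ℚ.toℚᵘ-fromℚᵘ A) (ℚᵘ.≃-trans (ℚ.toℚᵘ-homo‿- ((ℤ.+ 3) ℚ./ 4)) (ℚᵘ.-‿cong (ℚ.toℚᵘ-fromℚᵘ B))))))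
  open WinRatio M X Y W rel split using (4W≤3X; small)
  unnormalised : ℚᵘ.∣ A ℚᵘ.+ ℚᵘ.- B ∣ ℚᵘ.< ℚᵘ.mkℚᵘ ℤ.+[1+ k ] d-1
  unnormalised = ℚᵘ.*<* (subst₂ ℤ._<_ (sym (trans (cong (λ z → ℤ.+ z ℤ.* ℤ.+ suc d-1) (∣W·4-3·X∣ W X 4W≤3X)) (+*+ (3 * X ∸ 4 * W) (suc d-1))))
                                       (sym (+*+ (suc k) (X * 4)))
                                       (ℤ.+<+ (<-≤-trans (small (suc d-1) 1≤Y d≤M) (≤-trans (≤-reflexive (*-comm 4 X)) (m≤n*m (X * 4) (suc k))))))

-- Strike probabilities and optimality

count≡0⇒false : ∀ {A : Set} (p : A → Bool) v xs → v ∈ xs → count p xs ≡ 0 → p v ≡ false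
count≡0⇒false p v (x ∷ xs) (here refl) none with p x in px
... | false = refl
count≡0⇒false p v (x ∷ xs) (there v∈) none =
  count≡0⇒false p v xs v∈ (m+n≡0⇒n≡0 (indicator (p x)) (trans (sym (count-∷ p x xs)) none))

count-Av123-mono : ∀ N (q q′ : List ℕ → Bool) →
  (∀ π → length π ≡ N → all (inRange N) π ≡ true → isAv123 π ≡ true → q π ≡ true → q′ π ≡ true) →
  count q (Av123 N) ≤ count q′ (Av123 N)
count-Av123-mono N q q′ q⇒q′ =
  ≤-trans (count-mono (Av123 N) (λ π qπ → ∨-introˡ (q′ π) qπ)) (≤-reflexive (sym (count-Av123-cong N q′ (λ π → q π ∨ q′ π) absorb)))
  where
  absorb : ∀ π → length π ≡ N → all (inRange N) π ≡ true → isAv123 π ≡ true → q′ π ≡ (q π ∨ q′ π)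
  absorb π len inπ av with q π in qπ
  ... | true  = q⇒q′ π len inπ av qπ
  ... | false = refl

Av123-length : ∀ N π → π ∈ Av123 N → length π ≡ N
Av123-length N π π∈ = ≡ᵇ-sound (not-false (count≡0⇒false (λ σ → not (length σ ≡ᵇ N)) π (Av123 N) π∈ none))
  where
  not-false : ∀ {b} → not b ≡ false → b ≡ true
  not-false {true} _ = refl
  none : count (λ σ → not (length σ ≡ᵇ N)) (Av123 N) ≡ 0
  none = trans (count-Av123 N _) (trans (count-words-cong N N _ (λ _ → false)
    (λ σ len _ → trans (cong (λ n → isAv123 σ ∧ not (n ≡ᵇ N)) len) (trans (cong (λ u → isAv123 σ ∧ not u) (≡ᵇ-refl N)) (∧-zeroʳ (isAv123 σ)))))
    (count-false (words N N)))

length-restrict : ∀ π k → k ≤ length π → length (restrict π k) ≡ k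
length-restrict π k k≤len = trans (length-map _ (take k π)) (length-take-≤ k π k≤len)

PrefixStrikes : ℕ → Set
PrefixStrikes N = (k : ℕ) (p : List ℕ) → 1 ≤ k → k ≤ N → IsPrefix N k p →
  (2 ≤ k → p ≡ staircase k → strike N k p ≡ (ballot (N ∸ 1) (k ∸ 1) , ballot (N ∸ 1) (k ∸ 1)))
  × (p ≡ [ 1 ] → strike N k p ≡ (catalan (N ∸ 1) , catalan N))
  × (¬ (p ≡ [ 1 ]) → ¬ (2 ≤ k × p ≡ staircase k) → proj₁ (strike N k p) ≡ 0)

module Strikes (M′ : ℕ) where

  M : ℕ
  M = suc M′
  N : ℕ
  N = suc M
  open CountingAv123 M using (length-Av123; count-top-at)
  open Game M (s≤s z≤n) using (secondLRMax-wins; wins-only-later)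

  restrict-1-of-length : ∀ π → length π ≡ N → restrict π 1 ≡ [ 1 ]
  restrict-1-of-length (x ∷ σ) _ = restrict-1 x σ

  topFirst : List ℕ → Bool
  topFirst π = at π 1 ≡ᵇ N

  count-topFirst : count topFirst (Av123 N) ≡ catalan M
  count-topFirst = trans (count-top-at 0 z≤n) (trans (ballot≡complete-∸ M 0 z≤n) (sym (catalan≡complete M)))

  count-topFirst+rest : count topFirst (Av123 N) + count (λ π → not (topFirst π)) (Av123 N) ≡ catalan N
  count-topFirst+rest = trans (count+count-not topFirst (Av123 N)) length-Av123

  strike-staircase : ∀ j → 1 ≤ j → suc j ≤ N → strike N (suc j) (staircase (suc j)) ≡ (ballot M j , ballot M j)
  strike-staircase j 1≤j k≤N = cong₂ _,_
    (trans (count-Av123-cong N _ (λ π → at π (suc j) ≡ᵇ N)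
             (λ π len inπ av → trans (cong (_∧ (at π (suc j) ≡ᵇ N)) (staircase-prefix≡top-at π (suc j) M av inπ len (s≤s 1≤j) k≤N)) (∧-idem _)))
           (count-top-at j (≤-pred k≤N)))
    (trans (count-Av123-cong N _ (λ π → at π (suc j) ≡ᵇ N) (λ π len inπ av → staircase-prefix≡top-at π (suc j) M av inπ len (s≤s 1≤j) k≤N))
           (count-top-at j (≤-pred k≤N)))

  strike-one : strike N 1 [ 1 ] ≡ (catalan M , catalan N)
  strike-one = cong₂ _,_
    (trans (count-Av123-cong N _ topFirst (λ π len _ _ → cong (_∧ topFirst π) (is-one π len))) count-topFirst)
    (trans (count-Av123-cong N _ (λ _ → true) (λ π len _ _ → is-one π len)) (trans (sym (length≡count-true (Av123 N))) length-Av123))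
    where
    is-one : ∀ π → length π ≡ N → (restrict π 1 ==L [ 1 ]) ≡ true
    is-one π len = trans (cong (_==L [ 1 ]) (restrict-1-of-length π len)) (==L-true [ 1 ] [ 1 ] refl)

  strike-other : ∀ k p → 1 ≤ k → k ≤ N → ¬ (p ≡ [ 1 ]) → ¬ (2 ≤ k × p ≡ staircase k) → proj₁ (strike N k p) ≡ 0
  strike-other k p 1≤k k≤N p≢1 p≢stair = trans (count-Av123-cong N _ (λ _ → false) never) (count-false (Av123 N))
    where
    top-forces : ∀ π k → length π ≡ N → all (inRange N) π ≡ true → isAv123 π ≡ true → 1 ≤ k → k ≤ N →
      ¬ (2 ≤ k × p ≡ staircase k) → p ≡ restrict π k → at π k ≡ N → ⊥
    top-forces π (suc zero)       len _   _  _ _   _        p≡ _    = p≢1 (trans p≡ (restrict-1-of-length π len))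
    top-forces π (suc (suc k′)) len inπ av _ k≤N p≢stair′ p≡ at≡N =
      p≢stair′ (s≤s (s≤s z≤n) , trans p≡ (restrict-at-max π (suc (suc k′)) N av inπ len at≡N (s≤s z≤n) k≤N))
    never : ∀ π → length π ≡ N → all (inRange N) π ≡ true → isAv123 π ≡ true → ((restrict π k ==L p) ∧ (at π k ≡ᵇ N)) ≡ false
    never π len inπ av with at π k ≡ᵇ N in top
    ... | false = ∧-zeroʳ _
    ... | true with restrict π k ==L p in pref
    ...   | false = refl
    ...   | true  = ⊥-elim (top-forces π k len inπ av 1≤k k≤N p≢stair (sym (==L-sound _ _ pref)) (≡ᵇ-sound top))

  wins-secondLRMax : wins secondLRMax N ≡ count (λ π → not (topFirst π)) (Av123 N)
  wins-secondLRMax = count-Av123-cong N _ _ (λ π len inπ av → secondLRMax-wins π av inπ len)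

  wins-≤ : ∀ τ → wins τ N ≤ wins secondLRMax N
  wins-≤ τ = ≤-trans (by-first-move (τ [ 1 ]) refl) (≤-reflexive (sym wins-secondLRMax))
    where
    by-first-move : ∀ b → τ [ 1 ] ≡ b → wins τ N ≤ count (λ π → not (topFirst π)) (Av123 N)
    by-first-move true accept = begin
      wins τ N                                         ≡⟨ count-Av123-cong N _ topFirst (λ π len _ _ → accepts-first π len) ⟩
      count topFirst (Av123 N)                          ≡⟨ count-topFirst ⟩
      catalan M                                         ≤⟨ +-cancelˡ-≤ (catalan M) _ _ doubling ⟩
      count (λ π → not (topFirst π)) (Av123 N)          ∎
      where
      open ≤-Reasoning
      accepts-first : ∀ π → length π ≡ N → (at π (accepted τ N π) ≡ᵇ N) ≡ topFirst π
      accepts-first (x ∷ σ) _ = cong (λ a → at (x ∷ σ) a ≡ᵇ N) (accepted-first M′ τ x σ accept)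
      doubling : catalan M + catalan M ≤ catalan M + count (λ π → not (topFirst π)) (Av123 N)
      doubling = subst₂ _≤_ (cong (catalan M +_) (+-identityʳ (catalan M)))
                            (trans (sym count-topFirst+rest) (cong (_+ count (λ π → not (topFirst π)) (Av123 N)) count-topFirst))
                            (catalan-doubling M (s≤s z≤n))
    by-first-move false reject = count-Av123-mono N _ _ (λ π len inπ av win → wins-only-later τ π reject av win)

  optimal : ∀ τ → winProb τ N ℚ.≤ winProb secondLRMax N
  optimal τ = ÷-monoˡ-≤ (wins τ N) (wins secondLRMax N) (length (Av123 N)) (wins-≤ τ)

  winProb-close : ∀ (ε : ℚ.ℚ) → ℚ.0ℚ ℚ.< ε → ℚ.↧ₙ ε ≤ M → ℚ.∣ winProb secondLRMax N ℚ.- (ℤ.+ 3) ℚ./ 4 ∣ ℚ.< ε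
  winProb-close ε pos d≤M =
    subst₂ (λ w L → ℚ.∣ (w ÷ L) ℚ.- (ℤ.+ 3) ℚ./ 4 ∣ ℚ.< ε) (sym wins-secondLRMax) (sym (trans length-Av123 catalan≡suc))
      (close-to-3/4 M (pred (catalan N)) (catalan M) laterCount ε pos d≤M (catalan-pos M)
        (subst (λ x → suc (suc M) * x ≡ 2 * suc (2 * M) * catalan M) catalan≡suc (catalan-suc M))
        (trans (+-comm laterCount (catalan M)) (trans (cong (_+ laterCount) (sym count-topFirst)) (trans count-topFirst+rest catalan≡suc))))
    where
    laterCount : ℕ
    laterCount = count (λ π → not (topFirst π)) (Av123 N)
    catalan≡suc : catalan N ≡ suc (pred (catalan N))
    catalan≡suc = sym (suc-pred (catalan N) ⦃ >-nonZero (catalan-pos N) ⦄)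

  prefix-strikes : PrefixStrikes N
  prefix-strikes k p 1≤k k≤N (π , π∈ , restrict≡p) = staircase-case , one-case , strike-other k p 1≤k k≤N
    where
    staircase-case : 2 ≤ k → p ≡ staircase k → strike N k p ≡ (ballot M (k ∸ 1) , ballot M (k ∸ 1))
    staircase-case (s≤s 1≤j) refl = strike-staircase _ 1≤j k≤N
    one-case : p ≡ [ 1 ] → strike N k p ≡ (catalan M , catalan N)
    one-case refl = subst (λ k → strike N k [ 1 ] ≡ (catalan M , catalan N)) (sym k≡1) strike-one
      where
      k≡1 : k ≡ 1
      k≡1 = trans (sym (length-restrict π k (subst (k ≤_) (sym (Av123-length N π π∈)) k≤N))) (cong length restrict≡p)

proposition5p1 :
    ((N : ℕ) → 2 ≤ N →
      ((k : ℕ) (p : List ℕ) → 1 ≤ k → k ≤ N → IsPrefix N k p →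
         (2 ≤ k → p ≡ staircase k →
            strike N k p ≡ (ballot (N ∸ 1) (k ∸ 1) , ballot (N ∸ 1) (k ∸ 1)))
         × (p ≡ [ 1 ] → strike N k p ≡ (catalan (N ∸ 1) , catalan N))
         × (¬ (p ≡ [ 1 ]) → ¬ (2 ≤ k × p ≡ staircase k) → proj₁ (strike N k p) ≡ 0))
      × ((τ : Strategy) → winProb τ N ℚ.≤ winProb secondLRMax N))
    × ((ε : ℚ.ℚ) → ℚ.0ℚ ℚ.< ε →
        ∃ λ M → (N : ℕ) → M ≤ N → ℚ.∣ winProb secondLRMax N ℚ.- (ℤ.+ 3) ℚ./ 4 ∣ ℚ.< ε)
proposition5p1 = strikes-and-optimality , convergence
  where
  strikes-and-optimality : (N : ℕ) → 2 ≤ N → PrefixStrikes N × ((τ : Strategy) → winProb τ N ℚ.≤ winProb secondLRMax N)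
  strikes-and-optimality (suc (suc M′)) _        = Strikes.prefix-strikes M′ , Strikes.optimal M′
  strikes-and-optimality (suc zero)     (s≤s ())
  convergence : (ε : ℚ.ℚ) → ℚ.0ℚ ℚ.< ε → ∃ λ M → (N : ℕ) → M ≤ N → ℚ.∣ winProb secondLRMax N ℚ.- (ℤ.+ 3) ℚ./ 4 ∣ ℚ.< ε
  convergence ε pos = suc (suc (ℚ.↧ₙ ε)) , beyond
    where
    beyond : (N : ℕ) → suc (suc (ℚ.↧ₙ ε)) ≤ N → ℚ.∣ winProb secondLRMax N ℚ.- (ℤ.+ 3) ℚ./ 4 ∣ ℚ.< ε
    beyond (suc (suc M′)) (s≤s (s≤s d≤M′)) = Strikes.winProb-close M′ ε pos (m≤n⇒m≤1+n d≤M′)
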